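{- For every integer $k\ge 2$ there is a graph $G$ with $\operatorname{td}_2(G)\le k$ and $\operatorname{rtd}_2(G)\ge 2k-2$.
   Context: Rooted $2$-treedepth: $\operatorname{rtd}_2(G)=0$ if $G$ is the null graph; $=1$ if $G$ has one vertex; otherwise the minimum of $\max\{\operatorname{rtd}_2(A),\operatorname{rtd}_2(B-V(A))+|V(A)\cap V(B)|\}$ over all pairs $(A,B)$ of subgraphs with $A\cup B=G$, $E(A\cap B)=\emptyset$, $|V(A)\cap V(B)|\le 1$, $V(A)\ne\emptyset$, $V(B)\setminus V(A)\ne\emptyset$. A block of a graph is a maximal connected subgraph without a cut vertex. $2$-treedepth: $\operatorname{td}_2(X)=0$ if $X$ is null; $\operatorname{td}_2(X)=1+\min_{v}\operatorname{td}_2(X-v)$ if $X$ consists of one block; $\operatorname{td}_2(X)=\max_i\operatorname{td}_2(B_i)$ if $X$ consists of blocks $B_1,\dots,B_k$ with $k>1$. -}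

module Defs where

open import Data.Nat using (ℕ; zero; suc; _+_; _≤_)
open import Data.Fin using (Fin; _≟_)
open import Data.Bool using (Bool; true; false; _∧_; _∨_; not)
open import Data.Bool.Properties using (∧-comm)
open import Data.Fin.Subset using (Subset; ∣_∣)
open import Data.Vec using (tabulate)
open import Data.Product using (Σ; ∃; _×_; _,_)
open import Relation.Nullary using (¬_; does)
open import Relation.Binary.PropositionalEquality using (_≡_; refl; cong₂)

-- A finite simple graph whose vertex set is a subset of Fin n.
-- V v = true  iff v is a vertex; E x y = true iff xy is an edge.
record Graph (n : ℕ) : Set where
  field
    V     : Fin n → Bool
    E     : Fin n → Fin n → Bool
    E-sym : ∀ x y → E x y ≡ E y x
    E-irr : ∀ x → E x x ≡ false
    E-V   : ∀ x y → E x y ≡ true → V x ≡ true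
open Graph public

private
  ∧-trueˡ : ∀ {a b} → a ∧ b ≡ true → a ≡ true
  ∧-trueˡ {true} _ = refl

  ∧-trueʳ : ∀ {a b} → a ∧ b ≡ true → b ≡ true
  ∧-trueʳ {true} p = p

restrict : ∀ {n} → Graph n → (Fin n → Bool) → Graph n
restrict G keep = record
  { V     = λ w → V G w ∧ keep w
  ; E     = λ x y → E G x y ∧ (keep x ∧ keep y)
  ; E-sym = λ x y → cong₂ _∧_ (E-sym G x y) (∧-comm (keep x) (keep y))
  ; E-irr = irr
  ; E-V   = λ x y p → lem x y p
  }
  where
  irr : ∀ x → E G x x ∧ (keep x ∧ keep x) ≡ false
  irr x with E G x x | E-irr G x
  ... | false | _ = refl
  lem : ∀ x y → E G x y ∧ (keep x ∧ keep y) ≡ true → V G x ∧ keep x ≡ true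
  lem x y p with V G x | E-V G x y (∧-trueˡ p)
  ... | true | _ = ∧-trueˡ (∧-trueʳ {E G x y} p)

_─_ : ∀ {n} → Graph n → Fin n → Graph n
G ─ v = restrict G (λ w → not (does (w ≟ v)))

_∖_ : ∀ {n} → Graph n → Graph n → Graph n
B ∖ A = restrict B (λ w → not (V A w))

IsNull : ∀ {n} → Graph n → Set
IsNull G = ∀ v → V G v ≡ false

NonEmpty : ∀ {n} → Graph n → Set
NonEmpty G = ∃ λ v → V G v ≡ true

OneVertex : ∀ {n} → Graph n → Set
OneVertex G = ∃ λ v → V G v ≡ true × (∀ w → V G w ≡ true → w ≡ v)

IsUnion : ∀ {n} → Graph n → Graph n → Graph n → Set
IsUnion A B G = (∀ v → V G v ≡ (V A v ∨ V B v))
              × (∀ x y → E G x y ≡ (E A x y ∨ E B x y))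

NoCommonEdge : ∀ {n} → Graph n → Graph n → Set
NoCommonEdge A B = ∀ x y → (E A x y ∧ E B x y) ≡ false

commonVertices : ∀ {n} → Graph n → Graph n → Subset n
commonVertices A B = tabulate (λ v → V A v ∧ V B v)

-- RtdLe G k  means  rtd₂(G) ≤ k  (the min/max recursion unfolded)
data RtdLe {n : ℕ} : Graph n → ℕ → Set where
  rtd-null  : ∀ {G k} → IsNull G → RtdLe G k
  rtd-one   : ∀ {G k} → OneVertex G → RtdLe G (suc k)
  rtd-split : ∀ {G k} (A B : Graph n) (m : ℕ) →
              IsUnion A B G →
              NoCommonEdge A B →
              ∣ commonVertices A B ∣ ≤ 1 →
              NonEmpty A →
              NonEmpty (B ∖ A) →
              RtdLe A k →
              RtdLe (B ∖ A) m →
              m + ∣ commonVertices A B ∣ ≤ k →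
              RtdLe G k

_⊆G_ : ∀ {n} → Graph n → Graph n → Set
H ⊆G X = (∀ v → V H v ≡ true → V X v ≡ true)
       × (∀ x y → E H x y ≡ true → E X x y ≡ true)

SameGraph : ∀ {n} → Graph n → Graph n → Set
SameGraph A B = (∀ v → V A v ≡ V B v) × (∀ x y → E A x y ≡ E B x y)

data Reach {n : ℕ} (H : Graph n) : Fin n → Fin n → Set where
  here : ∀ {x} → V H x ≡ true → Reach H x x
  step : ∀ {x z y} → E H x z ≡ true → Reach H z y → Reach H x y

Connected : ∀ {n} → Graph n → Set
Connected H = ∀ x y → V H x ≡ true → V H y ≡ true → Reach H x y

HasCutVertex : ∀ {n} → Graph n → Set
HasCutVertex H = ∃ λ v → V H v ≡ true × ¬ Connected (H ─ v)

ConnNoCut : ∀ {n} → Graph n → Set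
ConnNoCut H = NonEmpty H × Connected H × ¬ HasCutVertex H

IsBlockOf : ∀ {n} → Graph n → Graph n → Set
IsBlockOf B X = B ⊆G X × ConnNoCut B
              × (∀ H → H ⊆G X → B ⊆G H → ConnNoCut H → H ⊆G B)

OneBlock : ∀ {n} → Graph n → Set
OneBlock X = IsBlockOf X X

SeveralBlocks : ∀ {n} → Graph n → Set
SeveralBlocks X = Σ _ λ B₁ → Σ _ λ B₂ →
  IsBlockOf B₁ X × IsBlockOf B₂ X × ¬ SameGraph B₁ B₂

-- TdLe X k  means  td₂(X) ≤ k
data TdLe {n : ℕ} : Graph n → ℕ → Set where
  td-null   : ∀ {X k} → IsNull X → TdLe X k
  td-block  : ∀ {X k} → OneBlock X → (v : Fin n) → V X v ≡ true →
              TdLe (X ─ v) k → TdLe X (suc k)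
  td-blocks : ∀ {X k} → SeveralBlocks X →
              (∀ B → IsBlockOf B X → TdLe B k) → TdLe X k

-- Let G₀ be a single vertex and let G_{j+1} be a path of five blocks glued at cut vertices:
-- four cones over copies of G_j and, in the middle, one edge. A cone adds one to td₂ and
-- blocks glued at cut vertices take the maximum, so td₂(G_j) ≤ j + 1.
-- For rtd₂, a decomposition (A, B) either keeps a cone C with apex a inside one side or spends
-- a level on the common vertex, so rtd₂ of any supergraph of C exceeds rtd₂(C − a); two cones
-- sharing one non-apex vertex force a further level. Whatever vertex x is deleted from
-- G_{j+1}, one of the two outer pairs of cones survives, and each cone minus any non-apex
-- vertex is a cone over G_j minus a vertex. Induction on rtd₂(G_j − x) ≥ 2j then gives
-- rtd₂(G_{j+1} − x) ≥ 2j + 2.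

module Submission where

open import Defs
open import Data.Bool using (Bool; true; false; _∧_; _∨_; not)
open import Data.Bool.Properties using (not-¬; ¬-not; ∨-comm; T-≡)
import Data.Bool as Bool
open import Data.Empty using (⊥; ⊥-elim)
open import Data.Fin using (Fin; zero; suc; _≟_; toℕ; fromℕ<)
open import Data.Fin.Properties using (any?; 0≢1+n; suc-injective; toℕ-injective; toℕ-fromℕ<)
open import Data.Fin.Subset using (∣_∣)
open import Data.Nat using (ℕ; zero; suc; _+_; _*_; _∸_; _≤_; _<_; _⊔_; _≤?_; z≤n; s≤s)
import Data.Nat as ℕ
open import Data.Nat.Properties
  using (≤-trans; ≤-refl; ≤-reflexive; ≤-antisym; >⇒≢; m≤n⇒m≤1+n; m≤m+n; n≤1+n; +-monoʳ-≤; +-comm; +-identityʳ; m≤m⊔n; m≤n⊔m; ≰⇒>; ⊔-lub; <-irrefl; ≤-<-trans; ∸-monoˡ-≤; m≤n+m∸n; <⇒≢; ≡ᵇ⇒≡; ≡⇒≡ᵇ; +-suc)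
open import Data.Nat.Tactic.RingSolver using (solve-∀)
open import Data.Product using (Σ; ∃; _×_; _,_; proj₁; proj₂)
open import Data.Sum using (_⊎_; inj₁; inj₂; [_,_])
open import Data.Vec using (tabulate)
open import Function using (Equivalence)
open import Relation.Nullary using (¬_; does; yes; no)
open import Relation.Nullary.Decidable using (dec-true; dec-false)
open import Relation.Binary.PropositionalEquality
  using (_≡_; _≢_; refl; sym; trans; cong; cong₂; subst; ≢-sym)

∧-trueˡ : ∀ {a b} → a ∧ b ≡ true → a ≡ true
∧-trueˡ {true} _ = refl

∧-trueʳ : ∀ {a b} → a ∧ b ≡ true → b ≡ true
∧-trueʳ {true} p = p

∧-true : ∀ {a b} → a ≡ true → b ≡ true → a ∧ b ≡ true
∧-true refl refl = refl

∧-falseˡ : ∀ {a b} → a ∧ b ≡ false → b ≡ true → a ≡ false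
∧-falseˡ {false} _ _ = refl
∧-falseˡ {true} p refl = p

∨-true : ∀ {a b} → a ∨ b ≡ true → a ≡ true ⊎ b ≡ true
∨-true {true} _ = inj₁ refl
∨-true {false} p = inj₂ p

∨-trueˡ : ∀ {a} b → a ≡ true → a ∨ b ≡ true
∨-trueˡ _ refl = refl

∨-trueʳ : ∀ a {b} → b ≡ true → a ∨ b ≡ true
∨-trueʳ true _ = refl
∨-trueʳ false p = p

not-true : ∀ {a} → not a ≡ true → a ≡ false
not-true {false} _ = refl

not-false : ∀ {a} → a ≡ false → not a ≡ true
not-false refl = refl

E-Vʳ : ∀ {n} (G : Graph n) x y → E G x y ≡ true → V G y ≡ true
E-Vʳ G x y p = E-V G y x (trans (E-sym G y x) p)

E⇒≢ : ∀ {n} (G : Graph n) x y → E G x y ≡ true → x ≢ y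
E⇒≢ G x .x p refl = not-¬ p (E-irr G x)

≢⇒kept : ∀ {n} {w v : Fin n} → w ≢ v → not (does (w ≟ v)) ≡ true
≢⇒kept {w = w} {v} w≢v = cong not (dec-false (w ≟ v) w≢v)

kept⇒≢ : ∀ {n} {w v : Fin n} → not (does (w ≟ v)) ≡ true → w ≢ v
kept⇒≢ {w = w} {v} p w≡v = not-¬ p (cong not (dec-true (w ≟ v) w≡v))

V-─⁻ : ∀ {n} (G : Graph n) v w → V (G ─ v) w ≡ true → V G w ≡ true × w ≢ v
V-─⁻ G v w p = ∧-trueˡ p , kept⇒≢ (∧-trueʳ {V G w} p)

V-─⁺ : ∀ {n} (G : Graph n) v w → V G w ≡ true → w ≢ v → V (G ─ v) w ≡ true
V-─⁺ G v w p w≢v = ∧-true p (≢⇒kept w≢v)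

E-─⁻ : ∀ {n} (G : Graph n) v x y → E (G ─ v) x y ≡ true → E G x y ≡ true × x ≢ v × y ≢ v
E-─⁻ G v x y p = ∧-trueˡ p , kept⇒≢ (∧-trueˡ kept) , kept⇒≢ (∧-trueʳ {not (does (x ≟ v))} kept)
  where kept = ∧-trueʳ {E G x y} p

E-─⁺ : ∀ {n} (G : Graph n) v x y → E G x y ≡ true → x ≢ v → y ≢ v → E (G ─ v) x y ≡ true
E-─⁺ G v x y p x≢v y≢v = ∧-true p (∧-true (≢⇒kept x≢v) (≢⇒kept y≢v))

-- Record versions of _⊆G_ and SameGraph: unlike those Σ-types, they let Agda infer the graphs.
record _⊑_ {n} (H X : Graph n) : Set where
  constructor subgraph
  field
    vertex : ∀ v → V H v ≡ true → V X v ≡ true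
    edge   : ∀ x y → E H x y ≡ true → E X x y ≡ true
open _⊑_ public

record _≅_ {n} (A B : Graph n) : Set where
  constructor same
  field
    vertex-≡ : ∀ v → V A v ≡ V B v
    edge-≡   : ∀ x y → E A x y ≡ E B x y
open _≅_ public

⊑⇒⊆G : ∀ {n} {H X : Graph n} → H ⊑ X → H ⊆G X
⊑⇒⊆G H⊑X = vertex H⊑X , edge H⊑X

⊆G⇒⊑ : ∀ {n} {H X : Graph n} → H ⊆G X → H ⊑ X
⊆G⇒⊑ (vs , es) = subgraph vs es

⊑-refl : ∀ {n} {G : Graph n} → G ⊑ G
⊑-refl = subgraph (λ _ p → p) (λ _ _ p → p)

⊑-trans : ∀ {n} {A B C : Graph n} → A ⊑ B → B ⊑ C → A ⊑ C
⊑-trans A⊑B B⊑C = subgraph (λ v p → vertex B⊑C v (vertex A⊑B v p)) (λ x y p → edge B⊑C x y (edge A⊑B x y p))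

restrict-⊑ : ∀ {n} (G : Graph n) keep → restrict G keep ⊑ G
restrict-⊑ G keep = subgraph (λ _ p → ∧-trueˡ p) (λ _ _ p → ∧-trueˡ p)

─-⊑ : ∀ {n} (G : Graph n) v → (G ─ v) ⊑ G
─-⊑ G v = restrict-⊑ G _

─-mono : ∀ {n} {S T : Graph n} y → S ⊑ T → (S ─ y) ⊑ (T ─ y)
─-mono {S = S} {T} y S⊑T = subgraph
  (λ v p → let (q , v≢y) = V-─⁻ S y v p in V-─⁺ T y v (vertex S⊑T v q) v≢y)
  (λ a b p → let (q , a≢y , b≢y) = E-─⁻ S y a b p in E-─⁺ T y a b (edge S⊑T a b q) a≢y b≢y)

─-comm : ∀ {n} (C : Graph n) a c → ((C ─ a) ─ c) ⊑ ((C ─ c) ─ a)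
─-comm C a c = subgraph vertices edges
  where
  vertices : ∀ v → V ((C ─ a) ─ c) v ≡ true → V ((C ─ c) ─ a) v ≡ true
  vertices v p = let (p₁ , v≢c) = V-─⁻ (C ─ a) c v p ; (p₂ , v≢a) = V-─⁻ C a v p₁
                 in V-─⁺ (C ─ c) a v (V-─⁺ C c v p₂ v≢c) v≢a
  edges : ∀ x y → E ((C ─ a) ─ c) x y ≡ true → E ((C ─ c) ─ a) x y ≡ true
  edges x y p = let (p₁ , x≢c , y≢c) = E-─⁻ (C ─ a) c x y p ; (p₂ , x≢a , y≢a) = E-─⁻ C a x y p₁
                in E-─⁺ (C ─ c) a x y (E-─⁺ C c x y p₂ x≢c y≢c) x≢a y≢a

⊑-─ : ∀ {n} {P X : Graph n} x → P ⊑ X → (∀ v → V P v ≡ true → v ≢ x) → P ⊑ (X ─ x)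
⊑-─ {P = P} {X} x P⊑X avoids = subgraph
  (λ v p → V-─⁺ X x v (vertex P⊑X v p) (avoids v p))
  (λ a b p → E-─⁺ X x a b (edge P⊑X a b p) (avoids a (E-V P a b p)) (avoids b (E-Vʳ P a b p)))

≅⇒⊑ : ∀ {n} {A B : Graph n} → A ≅ B → A ⊑ B
≅⇒⊑ A≅B = subgraph (λ v p → trans (sym (vertex-≡ A≅B v)) p) (λ x y p → trans (sym (edge-≡ A≅B x y)) p)

≅-sym : ∀ {n} {A B : Graph n} → A ≅ B → B ≅ A
≅-sym A≅B = same (λ v → sym (vertex-≡ A≅B v)) (λ x y → sym (edge-≡ A≅B x y))

≅-refl : ∀ {n} {A : Graph n} → A ≅ A
≅-refl = same (λ _ → refl) (λ _ _ → refl)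

≅-─ : ∀ {n} {A B : Graph n} v → A ≅ B → (A ─ v) ≅ (B ─ v)
≅-─ v A≅B = same (λ w → cong (_∧ _) (vertex-≡ A≅B w)) (λ x y → cong (_∧ _) (edge-≡ A≅B x y))

⊑-antisym : ∀ {n} {A B : Graph n} → A ⊑ B → B ⊑ A → A ≅ B
⊑-antisym A⊑B B⊑A = same (λ v → bool-ext (vertex A⊑B v) (vertex B⊑A v)) (λ x y → bool-ext (edge A⊑B x y) (edge B⊑A x y))
  where
  bool-ext : ∀ {a b} → (a ≡ true → b ≡ true) → (b ≡ true → a ≡ true) → a ≡ b
  bool-ext {true} f _ = sym (f refl)
  bool-ext {false} {true} _ g = g refl
  bool-ext {false} {false} _ _ = refl

Reach-mono : ∀ {n} {S T : Graph n} → S ⊑ T → ∀ {x y} → Reach S x y → Reach T x y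
Reach-mono S⊑T (here p) = here (vertex S⊑T _ p)
Reach-mono S⊑T (step e r) = step (edge S⊑T _ _ e) (Reach-mono S⊑T r)

Reach-trans : ∀ {n} {S : Graph n} {x y z} → Reach S x y → Reach S y z → Reach S x z
Reach-trans (here _) r = r
Reach-trans (step e r) r′ = step e (Reach-trans r r′)

Connected-⊇ : ∀ {n} {S T : Graph n} → S ⊑ T → (∀ v → V T v ≡ true → V S v ≡ true) →
              Connected S → Connected T
Connected-⊇ S⊆T TVS conn x y p q = Reach-mono S⊆T (conn x y (TVS x p) (TVS y q))

Connected-≅ : ∀ {n} {S T : Graph n} → S ≅ T → Connected S → Connected T
Connected-≅ S≅T = Connected-⊇ (≅⇒⊑ S≅T) (vertex (≅⇒⊑ (≅-sym S≅T)))

null⊎nonEmpty : ∀ {n} (G : Graph n) → IsNull G ⊎ NonEmpty G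
null⊎nonEmpty G with any? (λ v → V G v Bool.≟ true)
... | yes ne = inj₂ ne
... | no empty = inj₁ (λ v → ¬-not (λ p → empty (v , p)))

count : ∀ {n} → (Fin n → Bool) → ℕ
count f = ∣ tabulate f ∣

count-mono : ∀ {n} (f g : Fin n → Bool) → (∀ v → f v ≡ true → g v ≡ true) → count f ≤ count g
count-mono {zero} f g f⇒g = z≤n
count-mono {suc n} f g f⇒g with f zero in f₀ | g zero in g₀
... | true  | true  = s≤s (count-mono _ _ (λ v → f⇒g (suc v)))
... | true  | false = ⊥-elim (not-¬ (f⇒g zero f₀) g₀)
... | false | true  = m≤n⇒m≤1+n (count-mono _ _ (λ v → f⇒g (suc v)))
... | false | false = count-mono _ _ (λ v → f⇒g (suc v))

count-pos : ∀ {n} (f : Fin n → Bool) x → f x ≡ true → 1 ≤ count f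
count-pos f zero p with f zero
count-pos f zero refl | true = s≤s z≤n
count-pos f (suc x) p with f zero
... | true = s≤s z≤n
... | false = count-pos (λ i → f (suc i)) x p

count-two : ∀ {n} (f : Fin n → Bool) x y → f x ≡ true → f y ≡ true → x ≢ y → 2 ≤ count f
count-two f zero zero _ _ x≢y = ⊥-elim (x≢y refl)
count-two f zero (suc y) px py _ with f zero
count-two f zero (suc y) refl py _ | true = s≤s (count-pos (λ i → f (suc i)) y py)
count-two f (suc x) zero px py _ with f zero
count-two f (suc x) zero px refl _ | true = s≤s (count-pos (λ i → f (suc i)) x px)
count-two f (suc x) (suc y) px py x≢y with f zero
... | true = s≤s (≤-trans (s≤s z≤n) (count-two (λ i → f (suc i)) x y px py (λ e → x≢y (cong suc e))))
... | false = count-two (λ i → f (suc i)) x y px py (λ e → x≢y (cong suc e))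

count-none : ∀ {n} (f : Fin n → Bool) → (∀ v → f v ≡ false) → count f ≡ 0
count-none {zero} f none = refl
count-none {suc n} f none with f zero in f₀
... | true = ⊥-elim (not-¬ f₀ (none zero))
... | false = count-none (λ i → f (suc i)) (λ v → none (suc v))

count-≤-suc-tail : ∀ {n} (f : Fin (suc n) → Bool) → count f ≤ suc (count (λ i → f (suc i)))
count-≤-suc-tail f with f zero
... | true = ≤-refl
... | false = n≤1+n _

count-≤1 : ∀ {n} (f : Fin n → Bool) c → (∀ v → f v ≡ true → v ≡ c) → count f ≤ 1
count-≤1 f zero only =
  ≤-trans (count-≤-suc-tail f) (s≤s (≤-reflexive (count-none _ λ v → ¬-not λ p → 0≢1+n (sym (only (suc v) p)))))
count-≤1 f (suc c) only with f zero in f₀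
... | true  = ⊥-elim (0≢1+n (only zero f₀))
... | false = count-≤1 (λ i → f (suc i)) c (λ v p → suc-injective (only (suc v) p))

infixl 7 _∩_
infixl 6 _∪_

_∩_ : ∀ {n} → Graph n → Graph n → Graph n
X ∩ Y = record
  { V = λ v → V X v ∧ V Y v
  ; E = λ x y → E X x y ∧ E Y x y
  ; E-sym = λ x y → cong₂ _∧_ (E-sym X x y) (E-sym Y x y)
  ; E-irr = λ x → cong (_∧ E Y x x) (E-irr X x)
  ; E-V = λ x y p → ∧-true (E-V X x y (∧-trueˡ p)) (E-V Y x y (∧-trueʳ {E X x y} p))
  }

_∪_ : ∀ {n} → Graph n → Graph n → Graph n
X ∪ Y = record
  { V = λ v → V X v ∨ V Y v
  ; E = λ x y → E X x y ∨ E Y x y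
  ; E-sym = λ x y → cong₂ _∨_ (E-sym X x y) (E-sym Y x y)
  ; E-irr = λ x → cong₂ _∨_ (E-irr X x) (E-irr Y x)
  ; E-V = λ x y p → [ (λ q → ∨-trueˡ (V Y x) (E-V X x y q)) , (λ q → ∨-trueʳ (V X x) (E-V Y x y q)) ] (∨-true p)
  }

V-∩⁻ : ∀ {n} (X Y : Graph n) v → V (X ∩ Y) v ≡ true → V X v ≡ true × V Y v ≡ true
V-∩⁻ X Y v p = ∧-trueˡ p , ∧-trueʳ {V X v} p

E-∩⁻ : ∀ {n} (X Y : Graph n) x y → E (X ∩ Y) x y ≡ true → E X x y ≡ true × E Y x y ≡ true
E-∩⁻ X Y x y p = ∧-trueˡ p , ∧-trueʳ {E X x y} p

V-∖⁻ : ∀ {n} (B A : Graph n) v → V (B ∖ A) v ≡ true → V B v ≡ true × V A v ≡ false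
V-∖⁻ B A v p = ∧-trueˡ p , not-true (∧-trueʳ {V B v} p)

V-∖⁺ : ∀ {n} (B A : Graph n) v → V B v ≡ true → V A v ≡ false → V (B ∖ A) v ≡ true
V-∖⁺ B A v p q = ∧-true p (not-false q)

E-∖⁻ : ∀ {n} (B A : Graph n) x y → E (B ∖ A) x y ≡ true → E B x y ≡ true × V A x ≡ false × V A y ≡ false
E-∖⁻ B A x y p = ∧-trueˡ p , not-true (∧-trueˡ kept) , not-true (∧-trueʳ {not (V A x)} kept)
  where kept = ∧-trueʳ {E B x y} p

E-∖⁺ : ∀ {n} (B A : Graph n) x y → E B x y ≡ true → V A x ≡ false → V A y ≡ false → E (B ∖ A) x y ≡ true
E-∖⁺ B A x y p q r = ∧-true p (∧-true (not-false q) (not-false r))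

∩-⊑ˡ : ∀ {n} {X Y : Graph n} → (X ∩ Y) ⊑ X
∩-⊑ˡ = subgraph (λ _ p → ∧-trueˡ p) (λ _ _ p → ∧-trueˡ p)

∩-⊑ʳ : ∀ {n} {X Y : Graph n} → (X ∩ Y) ⊑ Y
∩-⊑ʳ {X = X} = subgraph (λ v p → ∧-trueʳ {V X v} p) (λ x y p → ∧-trueʳ {E X x y} p)

∪-⊑ˡ : ∀ {n} {X Y : Graph n} → X ⊑ (X ∪ Y)
∪-⊑ˡ {Y = Y} = subgraph (λ v p → ∨-trueˡ (V Y v) p) (λ x y p → ∨-trueˡ (E Y x y) p)

∪-⊑ʳ : ∀ {n} {X Y : Graph n} → Y ⊑ (X ∪ Y)
∪-⊑ʳ {X = X} = subgraph (λ v p → ∨-trueʳ (V X v) p) (λ x y p → ∨-trueʳ (E X x y) p)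

∪-nullˡ : ∀ {n} {X Y : Graph n} → IsNull X → (X ∪ Y) ⊑ Y
∪-nullˡ {X = X} {Y} X-null = subgraph vertices edges
  where
  vertices : ∀ v → V X v ∨ V Y v ≡ true → V Y v ≡ true
  vertices v p with ∨-true p
  ... | inj₁ q = ⊥-elim (not-¬ q (X-null v))
  ... | inj₂ q = q
  edges : ∀ x y → E X x y ∨ E Y x y ≡ true → E Y x y ≡ true
  edges x y p with ∨-true p
  ... | inj₁ q = ⊥-elim (not-¬ (E-V X x y q) (X-null x))
  ... | inj₂ q = q

∪-comm-⊑ : ∀ {n} {X Y : Graph n} → (X ∪ Y) ⊑ (Y ∪ X)
∪-comm-⊑ {X = X} {Y} = subgraph (λ v p → trans (∨-comm (V Y v) (V X v)) p) (λ x y p → trans (∨-comm (E Y x y) (E X x y)) p)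

∪-nullʳ : ∀ {n} {X Y : Graph n} → IsNull Y → (X ∪ Y) ⊑ X
∪-nullʳ Y-null = ⊑-trans ∪-comm-⊑ (∪-nullˡ Y-null)

∪-connected : ∀ {n} {X Y : Graph n} w → V X w ≡ true → V Y w ≡ true →
              Connected X → Connected Y → Connected (X ∪ Y)
∪-connected {X = X} {Y} w Xw Yw X-conn Y-conn x y p q = Reach-trans (to-w x p) (from-w y q)
  where
  to-w : ∀ x → V (X ∪ Y) x ≡ true → Reach (X ∪ Y) x w
  to-w x p with ∨-true p
  ... | inj₁ r = Reach-mono ∪-⊑ˡ (X-conn x w r Xw)
  ... | inj₂ r = Reach-mono ∪-⊑ʳ (Y-conn x w r Yw)
  from-w : ∀ y → V (X ∪ Y) y ≡ true → Reach (X ∪ Y) w y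
  from-w y p with ∨-true p
  ... | inj₁ r = Reach-mono ∪-⊑ˡ (X-conn w y Xw r)
  ... | inj₂ r = Reach-mono ∪-⊑ʳ (Y-conn w y Yw r)

common-unique : ∀ {n} (A B : Graph n) → ∣ commonVertices A B ∣ ≤ 1 → ∀ {x y} →
                V A x ∧ V B x ≡ true → V A y ∧ V B y ≡ true → x ≡ y
common-unique A B card {x} {y} px py with x ≟ y
... | yes x≡y = x≡y
... | no x≢y with ≤-trans (count-two (λ v → V A v ∧ V B v) x y px py x≢y) card
...   | s≤s ()

module Union {n} (A B : Graph n) {G : Graph n} (U : IsUnion A B G) where

  ∪-vertex : ∀ {v} → V G v ≡ true → V A v ≡ true ⊎ V B v ≡ true
  ∪-vertex {v} p = ∨-true (trans (sym (proj₁ U v)) p)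

  ∪-edge : ∀ {x y} → E G x y ≡ true → E A x y ≡ true ⊎ E B x y ≡ true
  ∪-edge {x} {y} p = ∨-true (trans (sym (proj₂ U x y)) p)

  ⊑-splitˡ : ∀ {S} → S ⊑ G → (∀ v → V S v ≡ true → V A v ≡ true) →
             (∀ x y → E S x y ≡ true → E B x y ≡ true → ⊥) → S ⊑ A
  ⊑-splitˡ {S} S⊑G inside no-B-edge = subgraph inside edges
    where
    edges : ∀ x y → E S x y ≡ true → E A x y ≡ true
    edges x y p with ∪-edge (edge S⊑G x y p)
    ... | inj₁ q = q
    ... | inj₂ q = ⊥-elim (no-B-edge x y p q)

  ⊑-splitʳ : ∀ {S} → S ⊑ G → (∀ v → V S v ≡ true → V A v ≡ false) → S ⊑ (B ∖ A)
  ⊑-splitʳ {S} S⊑G outside = subgraph vertices edges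
    where
    vertices : ∀ v → V S v ≡ true → V (B ∖ A) v ≡ true
    vertices v p with ∪-vertex (vertex S⊑G v p)
    ... | inj₁ q = ⊥-elim (not-¬ q (outside v p))
    ... | inj₂ q = V-∖⁺ B A v q (outside v p)
    edges : ∀ x y → E S x y ≡ true → E (B ∖ A) x y ≡ true
    edges x y p with ∪-edge (edge S⊑G x y p)
    ... | inj₁ q = ⊥-elim (not-¬ (E-V A x y q) (outside x (E-V S x y p)))
    ... | inj₂ q = E-∖⁺ B A x y q (outside x (E-V S x y p)) (outside y (E-Vʳ S x y p))

-- Rooted 2-treedepth

RtdLe-weaken : ∀ {n} {G : Graph n} {m k} → RtdLe G m → m ≤ k → RtdLe G k
RtdLe-weaken (rtd-null G-null) _ = rtd-null G-null
RtdLe-weaken (rtd-one one) (s≤s _) = rtd-one one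
RtdLe-weaken (rtd-split A B m U NC card neA neB dA dB le) m≤k =
  rtd-split A B m U NC card neA neB (RtdLe-weaken dA m≤k) dB (≤-trans le m≤k)

module _ {n} (A B : Graph n) {G S : Graph n} (U : IsUnion A B G) (S⊑G : S ⊑ G) where

  IsUnion-∩ : IsUnion (A ∩ S) (B ∩ S) S
  IsUnion-∩ = (λ v → absorb (V A v) (V B v) (V S v) (λ p → trans (sym (proj₁ U v)) (vertex S⊑G v p)))
            , (λ x y → absorb (E A x y) (E B x y) (E S x y) (λ p → trans (sym (proj₂ U x y)) (edge S⊑G x y p)))
    where
    absorb : ∀ a b s → (s ≡ true → a ∨ b ≡ true) → s ≡ (a ∧ s) ∨ (b ∧ s)
    absorb true  b     true  _ = refl
    absorb false true  true  _ = refl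
    absorb false false true  h = sym (h refl)
    absorb true  true  false _ = refl
    absorb true  false false _ = refl
    absorb false true  false _ = refl
    absorb false false false _ = refl

  ∖-∩-⊑ : ((B ∩ S) ∖ (A ∩ S)) ⊑ (B ∖ A)
  ∖-∩-⊑ = subgraph vertices edges
    where
    vertices : ∀ v → V ((B ∩ S) ∖ (A ∩ S)) v ≡ true → V (B ∖ A) v ≡ true
    vertices v p =
      let (BSv , ASv) = V-∖⁻ (B ∩ S) (A ∩ S) v p ; (Bv , Sv) = V-∩⁻ B S v BSv
      in V-∖⁺ B A v Bv (∧-falseˡ ASv Sv)
    edges : ∀ x y → E ((B ∩ S) ∖ (A ∩ S)) x y ≡ true → E (B ∖ A) x y ≡ true
    edges x y p =
      let (BSxy , ASx , ASy) = E-∖⁻ (B ∩ S) (A ∩ S) x y p ; (Bxy , Sxy) = E-∩⁻ B S x y BSxy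
      in E-∖⁺ B A x y Bxy (∧-falseˡ ASx (E-V S x y Sxy)) (∧-falseˡ ASy (E-Vʳ S x y Sxy))

NoCommonEdge-∩ : ∀ {n} (A B S : Graph n) → NoCommonEdge A B → NoCommonEdge (A ∩ S) (B ∩ S)
NoCommonEdge-∩ A B S NC x y = disjoint (E A x y) (E B x y) (E S x y) (NC x y)
  where
  disjoint : ∀ a b s → a ∧ b ≡ false → (a ∧ s) ∧ (b ∧ s) ≡ false
  disjoint true  true  _     ()
  disjoint true  false true  _ = refl
  disjoint true  false false _ = refl
  disjoint false _     _     _ = refl

common-∩-≤ : ∀ {n} (A B S : Graph n) → ∣ commonVertices (A ∩ S) (B ∩ S) ∣ ≤ ∣ commonVertices A B ∣
common-∩-≤ A B S = count-mono _ _ λ v p →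
  let (ASv , BSv) = V-∩⁻ (A ∩ S) (B ∩ S) v p
  in ∧-true (proj₁ (V-∩⁻ A S v ASv)) (proj₁ (V-∩⁻ B S v BSv))

RtdLe-⊑ : ∀ {n} {G S : Graph n} {k} → RtdLe G k → S ⊑ G → RtdLe S k
RtdLe-⊑ (rtd-null G-null) S⊑G = rtd-null (λ v → ¬-not (λ p → not-¬ (vertex S⊑G v p) (G-null v)))
RtdLe-⊑ {S = S} (rtd-one (g , _ , only)) S⊑G with V S g in Sg
... | true = rtd-one (g , Sg , λ w p → only w (vertex S⊑G w p))
... | false = rtd-null (λ v → ¬-not (λ p → not-¬ (subst (λ w → V S w ≡ true) (only v (vertex S⊑G v p)) p) Sg))
RtdLe-⊑ {S = S} (rtd-split A B m U NC card neA neB dA dB le) S⊑G with null⊎nonEmpty (A ∩ S)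
... | inj₁ A∩S-null = RtdLe-weaken (RtdLe-⊑ dB (⊑-splitʳ S⊑G outside-A)) (≤-trans (m≤m+n m _) le)
  where
  open Union A B U
  outside-A : ∀ v → V S v ≡ true → V A v ≡ false
  outside-A v Sv = ∧-falseˡ (A∩S-null v) Sv
... | inj₂ neA′ with null⊎nonEmpty ((B ∩ S) ∖ (A ∩ S))
...   | inj₁ rest-null = RtdLe-⊑ dA (⊑-splitˡ S⊑G inside-A no-B-edge)
  where
  open Union A B U
  inside-A : ∀ v → V S v ≡ true → V A v ≡ true
  inside-A v Sv with ∪-vertex (vertex S⊑G v Sv)
  ... | inj₁ Av = Av
  ... | inj₂ Bv = forced (rest-null v) Bv Sv
    where
    forced : ∀ {a b s} → (b ∧ s) ∧ not (a ∧ s) ≡ false → b ≡ true → s ≡ true → a ≡ true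
    forced {true} _ _ _ = refl
    forced {false} () refl refl
  no-B-edge : ∀ x y → E S x y ≡ true → E B x y ≡ true → ⊥
  no-B-edge x y Sxy Bxy = E⇒≢ S x y Sxy (common-unique A B card
    (∧-true (inside-A x (E-V S x y Sxy)) (E-V B x y Bxy))
    (∧-true (inside-A y (E-Vʳ S x y Sxy)) (E-Vʳ B x y Bxy)))
...   | inj₂ neB′ = rtd-split (A ∩ S) (B ∩ S) m (IsUnion-∩ A B U S⊑G) (NoCommonEdge-∩ A B S NC)
                      (≤-trans (common-∩-≤ A B S) card) neA′ neB′
                      (RtdLe-⊑ dA (∩-⊑ˡ {Y = S})) (RtdLe-⊑ dB (∖-∩-⊑ A B U S⊑G)) (≤-trans (+-monoʳ-≤ m (common-∩-≤ A B S)) le)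

RtdGe : ∀ {n} → Graph n → ℕ → Set
RtdGe G h = ∀ m → RtdLe G m → h ≤ m

RtdGe-⊑ : ∀ {n} {S G : Graph n} {h} → S ⊑ G → RtdGe S h → RtdGe G h
RtdGe-⊑ S⊑G S-hard m dG = S-hard m (RtdLe-⊑ dG S⊑G)

RtdLe-∪ : ∀ {n} {X Y : Graph n} {p q} → (∀ v → V X v ≡ true → V Y v ≡ false) →
          RtdLe X p → RtdLe Y q → RtdLe (X ∪ Y) (p ⊔ q)
RtdLe-∪ {X = X} {Y} {p} {q} X∉Y dX dY with null⊎nonEmpty X | null⊎nonEmpty Y
... | inj₁ X-null | _ = RtdLe-weaken (RtdLe-⊑ dY (∪-nullˡ X-null)) (m≤n⊔m p q)
... | inj₂ _ | inj₁ Y-null = RtdLe-weaken (RtdLe-⊑ dX (∪-nullʳ Y-null)) (m≤m⊔n p q)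
... | inj₂ neX | inj₂ (y , Yy) =
  rtd-split X Y q ((λ _ → refl) , (λ _ _ → refl)) no-common-edge (≤-trans (≤-reflexive none-common) z≤n)
    neX (y , V-∖⁺ Y X y Yy (¬-not (λ Xy → not-¬ Yy (X∉Y y Xy))))
    (RtdLe-weaken dX (m≤m⊔n p q)) (RtdLe-⊑ dY (restrict-⊑ Y _)) bound
  where
  no-common-edge : NoCommonEdge X Y
  no-common-edge x y = ¬-not λ r → not-¬ (E-V Y x y (∧-trueʳ {E X x y} r)) (X∉Y x (E-V X x y (∧-trueˡ r)))
  none-common : ∣ commonVertices X Y ∣ ≡ 0
  none-common = count-none _ λ v → ¬-not λ r → not-¬ (∧-trueʳ {V X v} r) (X∉Y v (∧-trueˡ r))
  bound : q + ∣ commonVertices X Y ∣ ≤ p ⊔ q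
  bound = subst (_≤ p ⊔ q) (sym (trans (cong (q +_) none-common) (+-identityʳ q))) (m≤n⊔m p q)

IsUnion-⊑ : ∀ {n} {S H : Graph n} → S ⊑ H → IsUnion S H H
IsUnion-⊑ {S = S} {H} S⊑H = (λ v → absorbed (vertex S⊑H v)) , (λ x y → absorbed (edge S⊑H x y))
  where
  absorbed : ∀ {a b} → (a ≡ true → b ≡ true) → b ≡ a ∨ b
  absorbed {true} a⇒b = a⇒b refl
  absorbed {false} _ = refl

module _ {n} (H : Graph n) (c : Fin n) where

  private
    single : Graph n
    single = restrict H (λ w → does (w ≟ c))

    V-single⁺ : V H c ≡ true → V single c ≡ true
    V-single⁺ Hc = ∧-true Hc (dec-true (c ≟ c) refl)

    V-single⁻ : ∀ w → V single w ≡ true → w ≡ c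
    V-single⁻ w p with w ≟ c | ∧-trueʳ {V H w} p
    ... | yes w≡c | _ = w≡c

    no-edge-single : ∀ x y → E single x y ≡ false
    no-edge-single x y = ¬-not λ p → E⇒≢ single x y p
      (trans (V-single⁻ x (E-V single x y p)) (sym (V-single⁻ y (E-Vʳ single x y p))))

  RtdLe-─ : ∀ {m} → RtdLe (H ─ c) m → RtdLe H (suc m)
  RtdLe-─ {m} d with V H c in Hc
  ... | false = RtdLe-weaken (RtdLe-⊑ d (⊑-─ c ⊑-refl c∉H)) (n≤1+n m)
    where
    c∉H : ∀ v → V H v ≡ true → v ≢ c
    c∉H v Hv refl = not-¬ Hv Hc
  ... | true with null⊎nonEmpty (H ─ c)
  ...   | inj₁ rest-null = rtd-one (c , Hc , only-c)
    where
    only-c : ∀ w → V H w ≡ true → w ≡ c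
    only-c w Hw with w ≟ c
    ... | yes w≡c = w≡c
    ... | no w≢c = ⊥-elim (not-¬ (V-─⁺ H c w Hw w≢c) (rest-null w))
  ...   | inj₂ (v , H─c-v) =
    rtd-split single H m (IsUnion-⊑ (restrict-⊑ H _)) (λ x y → cong (_∧ E H x y) (no-edge-single x y)) card
      (c , single-c) (v , V-∖⁺ H single v Hv (¬-not λ single-v → v≢c (V-single⁻ v single-v)))
      (rtd-one (c , single-c , V-single⁻)) (RtdLe-⊑ d H∖single⊑H─c) bound
    where
    single-c = V-single⁺ Hc
    Hv = proj₁ (V-─⁻ H c v H─c-v)
    v≢c = proj₂ (V-─⁻ H c v H─c-v)
    card : ∣ commonVertices single H ∣ ≤ 1
    card = count-≤1 _ c λ w p → V-single⁻ w (∧-trueˡ p)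
    H∖single⊑H─c : (H ∖ single) ⊑ (H ─ c)
    H∖single⊑H─c = ⊑-─ c (restrict-⊑ H _) λ { w p refl → let (Hc′ , ¬single-c) = V-∖⁻ H single w p in not-¬ (V-single⁺ Hc′) ¬single-c }
    bound : m + ∣ commonVertices single H ∣ ≤ suc m
    bound = ≤-trans (+-monoʳ-≤ m card) (≤-reflexive (+-comm m 1))

-- Lower bounds from cones and bouquets

record Cone {n} (C : Graph n) (a : Fin n) : Set where
  field
    apex     : V C a ≡ true
    adjacent : ∀ v → V C v ≡ true → v ≢ a → E C a v ≡ true
open Cone public

Cone⇒Connected : ∀ {n} {C : Graph n} {a} → Cone C a → Connected C
Cone⇒Connected {C = C} {a} cone x y Cx Cy with x ≟ a | y ≟ a
... | yes refl | yes refl = here Cx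
... | yes refl | no y≢a = step (adjacent cone y Cy y≢a) (here Cy)
... | no x≢a | yes refl = step (trans (E-sym C x a) (adjacent cone x Cx x≢a)) (here Cy)
... | no x≢a | no y≢a =
  step (trans (E-sym C x a) (adjacent cone x Cx x≢a)) (step (adjacent cone y Cy y≢a) (here Cy))

Cone-─ : ∀ {n} {C : Graph n} {a} c → Cone C a → c ≢ a → Cone (C ─ c) a
Cone-─ {C = C} {a} c cone c≢a = record
  { apex = V-─⁺ C c a (apex cone) (≢-sym c≢a)
  ; adjacent = λ v p v≢a → let (Cv , v≢c) = V-─⁻ C c v p in E-─⁺ C c a v (adjacent cone v Cv v≢a) (≢-sym c≢a) v≢c
  }

Cone-─-Connected : ∀ {n} {C : Graph n} {a} → Cone C a → Connected (C ─ a) → ∀ c → Connected (C ─ c)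
Cone-─-Connected {a = a} cone C─a-conn c with c ≟ a
... | yes refl = C─a-conn
... | no c≢a = Cone⇒Connected (Cone-─ c cone c≢a)

module Separation {n} (A B : Graph n) {G : Graph n} (U : IsUnion A B G)
                  (card : ∣ commonVertices A B ∣ ≤ 1) where
  open Union A B {G} U

  Avoids : Graph n → Set
  Avoids S = ∀ v → V S v ≡ true → V A v ∧ V B v ≡ false

  common-in? : ∀ S → (∃ λ c → V S c ≡ true × V A c ∧ V B c ≡ true) ⊎ Avoids S
  common-in? S with any? (λ v → (V S v ∧ (V A v ∧ V B v)) Bool.≟ true)
  ... | yes (c , p) = inj₁ (c , ∧-trueˡ p , ∧-trueʳ {V S c} p)
  ... | no none = inj₂ λ v Sv → ¬-not λ common → none (v , ∧-true Sv common)

  avoids-─ : ∀ {S c} → V A c ∧ V B c ≡ true → Avoids (S ─ c)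
  avoids-─ {S} {c} cc v p = ¬-not λ common → proj₂ (V-─⁻ S c v p) (common-unique A B card common cc)

  edge-keeps-side : ∀ {S} → S ⊑ G → Avoids S → ∀ {x z} → E S x z ≡ true → V A x ≡ V A z
  edge-keeps-side {S} S⊑G avoids {x} {z} e with ∪-edge (edge S⊑G x z e)
  ... | inj₁ Axz = trans (E-V A x z Axz) (sym (E-Vʳ A x z Axz))
  ... | inj₂ Bxz = trans (∧-falseˡ (avoids x (E-V S x z e)) (E-V B x z Bxz))
                         (sym (∧-falseˡ (avoids z (E-Vʳ S x z e)) (E-Vʳ B x z Bxz)))

  walk-keeps-side : ∀ {S} → S ⊑ G → Avoids S → ∀ {x y} → Reach S x y → V A x ≡ V A y
  walk-keeps-side S⊑G avoids (here _) = refl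
  walk-keeps-side S⊑G avoids (step e r) = trans (edge-keeps-side S⊑G avoids e) (walk-keeps-side S⊑G avoids r)

  connected-side : ∀ {S} → S ⊑ G → Connected S → Avoids S → NonEmpty S → S ⊑ A ⊎ S ⊑ (B ∖ A)
  connected-side {S} S⊑G conn avoids (s , Ss) with V A s in As
  ... | true = inj₁ (⊑-splitˡ S⊑G inside no-B-edge)
    where
    inside : ∀ v → V S v ≡ true → V A v ≡ true
    inside v Sv = trans (sym (walk-keeps-side S⊑G avoids (conn s v Ss Sv))) As
    no-B-edge : ∀ x y → E S x y ≡ true → E B x y ≡ true → ⊥
    no-B-edge x y Sxy Bxy = not-¬ (∧-true (inside x (E-V S x y Sxy)) (E-V B x y Bxy)) (avoids x (E-V S x y Sxy))
  ... | false = inj₂ (⊑-splitʳ S⊑G λ v Sv → trans (sym (walk-keeps-side S⊑G avoids (conn s v Ss Sv))) As)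

  extend : ∀ {C c} → C ⊑ G → V A c ∧ V B c ≡ true → (C ─ c) ⊑ A → C ⊑ A
  extend {C} {c} C⊑G cc C─c⊑A = subgraph vertices edges
    where
    vertices : ∀ v → V C v ≡ true → V A v ≡ true
    vertices v Cv with v ≟ c
    ... | yes refl = ∧-trueˡ cc
    ... | no v≢c = vertex C─c⊑A v (V-─⁺ C c v Cv v≢c)
    edges : ∀ x y → E C x y ≡ true → E A x y ≡ true
    edges x y Cxy with x ≟ c | y ≟ c | ∪-edge (edge C⊑G x y Cxy)
    ... | _ | _ | inj₁ Axy = Axy
    ... | no x≢c | no y≢c | inj₂ _ = edge C─c⊑A x y (E-─⁺ C c x y Cxy x≢c y≢c)
    ... | yes refl | no y≢c | inj₂ Bxy =
      ⊥-elim (y≢c (common-unique A B card (∧-true (vertices y (E-Vʳ C x y Cxy)) (E-Vʳ B x y Bxy)) cc))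
    ... | no x≢c | yes refl | inj₂ Bxy =
      ⊥-elim (x≢c (common-unique A B card (∧-true (vertices x (E-V C x y Cxy)) (E-V B x y Bxy)) cc))
    ... | yes refl | yes refl | inj₂ _ = ⊥-elim (E⇒≢ C x x Cxy refl)

RtdGe-∪-cover : ∀ {n} {S X Y : Graph n} {h m} → S ⊑ (X ∪ Y) → (∀ v → V X v ≡ true → V Y v ≡ false) →
                RtdLe Y m → m < h → RtdGe S h → RtdGe X h
RtdGe-∪-cover {h = h} {m} S⊑X∪Y X∉Y dY m<h S-hard p dX with h ≤? p
... | yes h≤p = h≤p
... | no h≰p = ⊥-elim (<-irrefl refl (≤-<-trans (S-hard (p ⊔ m) (RtdLe-⊑ (RtdLe-∪ X∉Y dX dY) S⊑X∪Y))
                                                 (⊔-lub (≰⇒> h≰p) m<h)))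

RtdGe-─-─ : ∀ {n} {C : Graph n} {a h} c → RtdGe (C ─ a) h → RtdGe ((C ─ c) ─ a) (h ∸ 1)
RtdGe-─-─ {C = C} {a} c C─a-hard p dp = ∸-monoˡ-≤ 1 (C─a-hard (suc p) (RtdLe-─ (C ─ a) c (RtdLe-⊑ dp (─-comm C a c))))

ConeBound : ∀ {n} → Graph n → ℕ → Set
ConeBound G k = ∀ {C a h} → C ⊑ G → Cone C a → RtdGe (C ─ a) h → suc h ≤ k

record Bouquet {n} (C C′ : Graph n) (a a′ z : Fin n) (h : ℕ) : Set where
  field
    cone        : Cone C a
    cone′       : Cone C′ a′
    joint       : V C z ≡ true
    joint′      : V C′ z ≡ true
    joint≢apex  : z ≢ a
    joint≢apex′ : z ≢ a′
    meet        : ∀ v → V C v ≡ true → V C′ v ≡ true → v ≡ z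
    connected   : Connected (C ─ a)
    connected′  : Connected (C′ ─ a′)
    robust      : ∀ y → y ≢ a → RtdGe (C ─ y) h
    robust′     : ∀ y → y ≢ a′ → RtdGe (C′ ─ y) h

Bouquet-sym : ∀ {n} {C C′ : Graph n} {a a′ z h} → Bouquet C C′ a a′ z h → Bouquet C′ C a′ a z h
Bouquet-sym b = record
  { cone = cone′ ; cone′ = cone ; joint = joint′ ; joint′ = joint
  ; joint≢apex = joint≢apex′ ; joint≢apex′ = joint≢apex ; meet = λ v p q → meet v q p
  ; connected = connected′ ; connected′ = connected ; robust = robust′ ; robust′ = robust
  }
  where open Bouquet b

Bouquet⇒RtdGe : ∀ {n} {C C′ : Graph n} {a a′ z h} → Bouquet C C′ a a′ z h → RtdGe C h
Bouquet⇒RtdGe {C = C} {z = z} b = RtdGe-⊑ (─-⊑ C z) (robust z joint≢apex)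
  where open Bouquet b

BouquetBound : ∀ {n} → Graph n → ℕ → Set
BouquetBound G k = ∀ {C C′ a a′ z h} → Bouquet C C′ a a′ z h → C ⊑ G → C′ ⊑ G → suc h ≤ k

module SplitBounds {n} (A B : Graph n) {G : Graph n} (U : IsUnion A B G)
                   (card : ∣ commonVertices A B ∣ ≤ 1) {m k} (dB : RtdLe (B ∖ A) m)
                   (le : m + ∣ commonVertices A B ∣ ≤ k) where
  open Union A B {G} U
  open Separation A B {G} U card

  suc-m≤k : ∀ {c} → V A c ∧ V B c ≡ true → suc m ≤ k
  suc-m≤k {c} cc = ≤-trans (≤-trans (≤-reflexive (+-comm 1 m)) (+-monoʳ-≤ m (count-pos _ c cc))) le

  m≤k : m ≤ k
  m≤k = ≤-trans (m≤m+n m _) le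

  Cone-∩ : ∀ {C a} → C ⊑ G → Cone C a → V A a ∧ V B a ≡ true → Cone (C ∩ A) a
  Cone-∩ {C} {a} C⊑G cone aa = record { apex = ∧-true (apex cone) (∧-trueˡ aa) ; adjacent = adj }
    where
    adj : ∀ v → V (C ∩ A) v ≡ true → v ≢ a → E (C ∩ A) a v ≡ true
    adj v p v≢a with ∪-edge (edge C⊑G a v (adjacent cone v (proj₁ (V-∩⁻ C A v p)) v≢a))
    ... | inj₁ Aav = ∧-true (adjacent cone v (proj₁ (V-∩⁻ C A v p)) v≢a) Aav
    ... | inj₂ Bav = ⊥-elim (v≢a (common-unique A B card (∧-true (proj₂ (V-∩⁻ C A v p)) (E-Vʳ B a v Bav)) aa))

  ─-⊑-sides : ∀ {C a} → C ⊑ G → V A a ∧ V B a ≡ true →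
              (C ─ a) ⊑ (((C ∩ A) ─ a) ∪ ((C ─ a) ∩ (B ∖ A)))
  ─-⊑-sides {C} {a} C⊑G aa = subgraph vertices edges
    where
    not-common : ∀ {v} → v ≢ a → V B v ≡ true → V A v ≡ false
    not-common {v} v≢a Bv = ¬-not λ Av → v≢a (common-unique A B card (∧-true Av Bv) aa)
    vertices : ∀ v → V (C ─ a) v ≡ true → V (((C ∩ A) ─ a) ∪ ((C ─ a) ∩ (B ∖ A))) v ≡ true
    vertices v p with V-─⁻ C a v p | ∪-vertex (vertex C⊑G v (proj₁ (V-─⁻ C a v p)))
    ... | Cv , v≢a | inj₁ Av = ∨-trueˡ _ (V-─⁺ (C ∩ A) a v (∧-true Cv Av) v≢a)
    ... | Cv , v≢a | inj₂ Bv = ∨-trueʳ _ (∧-true p (V-∖⁺ B A v Bv (not-common v≢a Bv)))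
    edges : ∀ x y → E (C ─ a) x y ≡ true → E (((C ∩ A) ─ a) ∪ ((C ─ a) ∩ (B ∖ A))) x y ≡ true
    edges x y p with E-─⁻ C a x y p | ∪-edge (edge C⊑G x y (proj₁ (E-─⁻ C a x y p)))
    ... | Cxy , x≢a , y≢a | inj₁ Axy = ∨-trueˡ _ (E-─⁺ (C ∩ A) a x y (∧-true Cxy Axy) x≢a y≢a)
    ... | Cxy , x≢a , y≢a | inj₂ Bxy = ∨-trueʳ _ (∧-true p
          (E-∖⁺ B A x y Bxy (not-common x≢a (E-V B x y Bxy)) (not-common y≢a (E-Vʳ B x y Bxy))))

  sides-disjoint : ∀ {C a} v → V ((C ∩ A) ─ a) v ≡ true → V ((C ─ a) ∩ (B ∖ A)) v ≡ false
  sides-disjoint {C} {a} v p = ¬-not λ q →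
    not-¬ (proj₂ (V-∩⁻ C A v (proj₁ (V-─⁻ (C ∩ A) a v p))))
          (proj₂ (V-∖⁻ B A v (proj₂ (V-∩⁻ (C ─ a) (B ∖ A) v q))))

  -- If the common vertex is the apex a and h > m, then C − a is covered by (C ∩ A) − a and a
  -- part of B ∖ A of rtd₂ at most m, so the A-side cone (C ∩ A) already carries the bound h.
  cone-split : ConeBound A k → ConeBound (B ∖ A) m → ConeBound G k
  cone-split recA recB {C} {a} {h} C⊑G cone hard with common-in? C
  ... | inj₂ avoids with connected-side C⊑G (Cone⇒Connected cone) avoids (a , apex cone)
  ...   | inj₁ C⊑A = recA C⊑A cone hard
  ...   | inj₂ C⊑B∖A = ≤-trans (recB C⊑B∖A cone hard) m≤k
  cone-split recA recB {C} {a} {h} C⊑G cone hard | inj₁ (c , _ , cc) with c ≟ a | h ≤? m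
  ... | yes refl | yes h≤m = ≤-trans (s≤s h≤m) (suc-m≤k cc)
  ... | yes refl | no h≰m = recA (∩-⊑ʳ {X = C}) (Cone-∩ C⊑G cone cc)
          (RtdGe-∪-cover (─-⊑-sides C⊑G cc) (sides-disjoint {C}) (RtdLe-⊑ dB (∩-⊑ʳ {X = C ─ c})) (≰⇒> h≰m) hard)
  ... | no c≢a | _ with connected-side (⊑-trans (─-⊑ C c) C⊑G) (Cone⇒Connected (Cone-─ c cone c≢a))
                                      (avoids-─ {C} cc) (a , apex (Cone-─ c cone c≢a))
  ...   | inj₁ C─c⊑A = recA (extend C⊑G cc C─c⊑A) cone hard
  ...   | inj₂ C─c⊑B∖A = ≤-trans (s≤s (m≤n+m∸n h 1))
          (≤-trans (s≤s (recB C─c⊑B∖A (Cone-─ c cone c≢a) (RtdGe-─-─ c hard))) (suc-m≤k cc))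

  side-clash : ∀ {S T z} → S ⊑ A → T ⊑ (B ∖ A) → V S z ≡ true → V T z ≡ true → ⊥
  side-clash {z = z} S⊑A T⊑B∖A Sz Tz = not-¬ (vertex S⊑A z Sz) (proj₂ (V-∖⁻ B A z (vertex T⊑B∖A z Tz)))

  module CommonInBouquet (recA : BouquetBound A k) {C C′ a a′ z h} (b : Bouquet C C′ a a′ z h)
                         (C⊑G : C ⊑ G) (C′⊑G : C′ ⊑ G) where
    open Bouquet b

    common-at-joint : V A z ∧ V B z ≡ true → suc h ≤ k
    common-at-joint zz with side C C⊑G cone connected joint≢apex | side C′ C′⊑G cone′ connected′ joint≢apex′
      where
      side : ∀ X {x} → X ⊑ G → Cone X x → Connected (X ─ x) → z ≢ x → (X ─ z) ⊑ A ⊎ (X ─ z) ⊑ (B ∖ A)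
      side X X⊑G cone-X conn-X z≢x = connected-side (⊑-trans (─-⊑ X z) X⊑G) (Cone-─-Connected cone-X conn-X z)
        (avoids-─ {X} zz) (_ , V-─⁺ X z _ (apex cone-X) (≢-sym z≢x))
    ... | inj₁ C─z⊑A | inj₁ C′─z⊑A = recA b (extend C⊑G zz C─z⊑A) (extend C′⊑G zz C′─z⊑A)
    ... | inj₂ C─z⊑B∖A | _ = ≤-trans (s≤s (robust z joint≢apex m (RtdLe-⊑ dB C─z⊑B∖A))) (suc-m≤k zz)
    ... | inj₁ _ | inj₂ C′─z⊑B∖A = ≤-trans (s≤s (robust′ z joint≢apex′ m (RtdLe-⊑ dB C′─z⊑B∖A))) (suc-m≤k zz)

    common-off-joint : ∀ {c} → V C c ≡ true → V A c ∧ V B c ≡ true → c ≢ z → suc h ≤ k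
    common-off-joint {c} Cc cc c≢z with connected-side C′⊑G (Cone⇒Connected cone′) avoids′ (a′ , apex cone′)
      where
      avoids′ : Avoids C′
      avoids′ v C′v = ¬-not λ vv → c≢z (meet c Cc (subst (λ w → V C′ w ≡ true) (common-unique A B card vv cc) C′v))
    ... | inj₂ C′⊑B∖A = ≤-trans (s≤s (Bouquet⇒RtdGe (Bouquet-sym b) m (RtdLe-⊑ dB C′⊑B∖A))) (suc-m≤k cc)
    ... | inj₁ C′⊑A with connected-side (⊑-trans (─-⊑ C c) C⊑G) (Cone-─-Connected cone connected c)
                                        (avoids-─ {C} cc) (z , C─c-z)
      where
      C─c-z : V (C ─ c) z ≡ true
      C─c-z = V-─⁺ C c z joint (≢-sym c≢z)
    ...   | inj₁ C─c⊑A = recA b (extend C⊑G cc C─c⊑A) C′⊑A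
    ...   | inj₂ C─c⊑B∖A = ⊥-elim (side-clash C′⊑A C─c⊑B∖A joint′ (V-─⁺ C c z joint (≢-sym c≢z)))

    common-in-bouquet : ∀ {c} → V C c ≡ true → V A c ∧ V B c ≡ true → suc h ≤ k
    common-in-bouquet {c} Cc cc with c ≟ z
    ... | yes refl = common-at-joint cc
    ... | no c≢z = common-off-joint Cc cc c≢z

  bouquet-split : BouquetBound A k → BouquetBound (B ∖ A) m → BouquetBound G k
  bouquet-split recA recB {C} {C′} {a} {a′} b C⊑G C′⊑G with common-in? C | common-in? C′
  ... | inj₁ (c , Cc , cc) | _ = CommonInBouquet.common-in-bouquet recA b C⊑G C′⊑G Cc cc
  ... | inj₂ _ | inj₁ (c , C′c , cc) = CommonInBouquet.common-in-bouquet recA (Bouquet-sym b) C′⊑G C⊑G C′c cc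
  ... | inj₂ avoids | inj₂ avoids′
    with connected-side C⊑G (Cone⇒Connected (Bouquet.cone b)) avoids (a , apex (Bouquet.cone b))
       | connected-side C′⊑G (Cone⇒Connected (Bouquet.cone′ b)) avoids′ (a′ , apex (Bouquet.cone′ b))
  ...   | inj₁ C⊑A | inj₁ C′⊑A = recA b C⊑A C′⊑A
  ...   | inj₂ C⊑B∖A | inj₂ C′⊑B∖A = ≤-trans (recB b C⊑B∖A C′⊑B∖A) m≤k
  ...   | inj₁ C⊑A | inj₂ C′⊑B∖A = ⊥-elim (side-clash C⊑A C′⊑B∖A (Bouquet.joint b) (Bouquet.joint′ b))
  ...   | inj₂ C⊑B∖A | inj₁ C′⊑A = ⊥-elim (side-clash C′⊑A C⊑B∖A (Bouquet.joint′ b) (Bouquet.joint b))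

cone-bound : ∀ {n} {G : Graph n} {k} → RtdLe G k → ConeBound G k
cone-bound (rtd-null G-null) C⊑G cone _ = ⊥-elim (not-¬ (vertex C⊑G _ (apex cone)) (G-null _))
cone-bound (rtd-one (g , _ , only)) {C} {a} C⊑G cone hard = s≤s (≤-trans (hard 0 (rtd-null C─a-null)) z≤n)
  where
  C─a-null : IsNull (C ─ a)
  C─a-null v = ¬-not λ p → let (Cv , v≢a) = V-─⁻ C a v p in
    v≢a (trans (only v (vertex C⊑G v Cv)) (sym (only a (vertex C⊑G a (apex cone)))))
cone-bound (rtd-split A B m U _ card _ _ dA dB le) =
  SplitBounds.cone-split A B U card dB le (cone-bound dA) (cone-bound dB)

bouquet-bound : ∀ {n} {G : Graph n} {k} → RtdLe G k → BouquetBound G k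
bouquet-bound (rtd-null G-null) b C⊑G _ = ⊥-elim (not-¬ (vertex C⊑G _ (Bouquet.joint b)) (G-null _))
bouquet-bound (rtd-one (g , _ , only)) b C⊑G _ =
  ⊥-elim (joint≢apex (trans (only _ (vertex C⊑G _ joint)) (sym (only _ (vertex C⊑G _ (apex cone))))))
  where open Bouquet b
bouquet-bound (rtd-split A B m U _ card _ _ dA dB le) =
  SplitBounds.bouquet-split A B U card dB le (bouquet-bound dA) (bouquet-bound dB)

-- 2-treedepth of graphs glued at cut vertices

isBlockOf : ∀ {n} {B X : Graph n} → B ⊑ X → ConnNoCut B →
            (∀ H → H ⊑ X → B ⊑ H → ConnNoCut H → H ⊑ B) → IsBlockOf B X
isBlockOf B⊑X cnc maximal = ⊑⇒⊆G B⊑X , cnc , λ H H⊆X B⊆H cncH → ⊑⇒⊆G (maximal H (⊆G⇒⊑ H⊆X) (⊆G⇒⊑ B⊆H) cncH)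

block-⊑ : ∀ {n} {B X : Graph n} → IsBlockOf B X → B ⊑ X
block-⊑ (B⊆X , _) = ⊆G⇒⊑ B⊆X

block-maximal : ∀ {n} {B X : Graph n} → IsBlockOf B X → ∀ H → H ⊑ X → B ⊑ H → ConnNoCut H → H ⊑ B
block-maximal (_ , _ , maximal) H H⊑X B⊑H cncH = ⊆G⇒⊑ (maximal H (⊑⇒⊆G H⊑X) (⊑⇒⊆G B⊑H) cncH)

ConnNoCut-≅ : ∀ {n} {A B : Graph n} → A ≅ B → ConnNoCut A → ConnNoCut B
ConnNoCut-≅ A≅B ((v , Av) , conn , no-cut) =
  (v , trans (sym (vertex-≡ A≅B v)) Av) , Connected-≅ A≅B conn ,
  λ { (w , Bw , cut) → no-cut (w , trans (vertex-≡ A≅B w) Bw , λ conn-w → cut (Connected-≅ (≅-─ w A≅B) conn-w)) }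

IsBlockOf-≅ : ∀ {n} {B B′ X X′ : Graph n} → B ≅ B′ → X ≅ X′ → IsBlockOf B X → IsBlockOf B′ X′
IsBlockOf-≅ B≅B′ X≅X′ block@(_ , cnc , _) =
  isBlockOf (⊑-trans (≅⇒⊑ (≅-sym B≅B′)) (⊑-trans (block-⊑ block) (≅⇒⊑ X≅X′))) (ConnNoCut-≅ B≅B′ cnc)
    λ H H⊑X′ B′⊑H cncH → ⊑-trans (block-maximal block H (⊑-trans H⊑X′ (≅⇒⊑ (≅-sym X≅X′)))
                                   (⊑-trans (≅⇒⊑ B≅B′) B′⊑H) cncH) (≅⇒⊑ B≅B′)

TdLe-≅ : ∀ {n} {X X′ : Graph n} {k} → TdLe X k → X ≅ X′ → TdLe X′ k
TdLe-≅ (td-null X-null) X≅X′ = td-null λ v → trans (sym (vertex-≡ X≅X′ v)) (X-null v)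
TdLe-≅ (td-block one v Xv d) X≅X′ =
  td-block (IsBlockOf-≅ X≅X′ X≅X′ one) v (trans (sym (vertex-≡ X≅X′ v)) Xv) (TdLe-≅ d (≅-─ v X≅X′))
TdLe-≅ (td-blocks (B₁ , B₂ , b₁ , b₂ , B₁≉B₂) f) X≅X′ =
  td-blocks (B₁ , B₂ , IsBlockOf-≅ ≅-refl X≅X′ b₁ , IsBlockOf-≅ ≅-refl X≅X′ b₂ , B₁≉B₂)
    λ B b → f B (IsBlockOf-≅ ≅-refl (≅-sym X≅X′) b)

¬¬-true : ∀ {b} → ¬ ¬ (b ≡ true) → b ≡ true
¬¬-true {true} _ = refl
¬¬-true {false} ¬¬b = ⊥-elim (¬¬b λ ())

ConnNoCut⇒¬¬Connected-─ : ∀ {n} {B : Graph n} → ConnNoCut B → ∀ c → ¬ ¬ Connected (B ─ c)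
ConnNoCut⇒¬¬Connected-─ {B = B} (_ , conn , no-cut) c with V B c in Bc
... | true = λ cut → no-cut (c , Bc , cut)
... | false = λ ¬conn → ¬conn (Connected-⊇ (⊑-─ c ⊑-refl c∉B) (λ v p → proj₁ (V-─⁻ B c v p)) conn)
  where
  c∉B : ∀ v → V B v ≡ true → v ≢ c
  c∉B v Bv refl = not-¬ Bv Bc

module Glue {n} (X₁ X₂ : Graph n) (c : Fin n) (X₁c : V X₁ c ≡ true) (X₂c : V X₂ c ≡ true)
            (meet : ∀ v → V X₁ v ≡ true → V X₂ v ≡ true → v ≡ c) where

  walk-stays : ∀ {S} → S ⊑ (X₁ ∪ X₂) → (∀ u → V S u ≡ true → u ≢ c) →
               ∀ {x y} → Reach S x y → V X₁ x ≡ true → V X₁ y ≡ true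
  walk-stays S⊑X avoids (here _) X₁x = X₁x
  walk-stays {S} S⊑X avoids (step {x} {z} e r) X₁x with ∨-true (edge S⊑X x z e)
  ... | inj₁ X₁xz = walk-stays S⊑X avoids r (E-Vʳ X₁ x z X₁xz)
  ... | inj₂ X₂xz = ⊥-elim (avoids x (E-V S x z e) (meet x X₁x (E-V X₂ x z X₂xz)))

  block-side : ∀ {B} → ConnNoCut B → B ⊑ (X₁ ∪ X₂) → B ⊑ X₁ ⊎ B ⊑ X₂
  block-side {B} cnc B⊑X with any? (λ v → (V B v ∧ not (V X₂ v)) Bool.≟ true)
  ... | no none = inj₂ (subgraph in-X₂ edges)
    where
    in-X₂ : ∀ v → V B v ≡ true → V X₂ v ≡ true
    in-X₂ v Bv = ¬¬-true λ ¬X₂v → none (v , ∧-true Bv (not-false (¬-not ¬X₂v)))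
    edges : ∀ x y → E B x y ≡ true → E X₂ x y ≡ true
    edges x y Bxy with ∨-true (edge B⊑X x y Bxy)
    ... | inj₂ X₂xy = X₂xy
    ... | inj₁ X₁xy = ⊥-elim (E⇒≢ B x y Bxy (trans (meet x (E-V X₁ x y X₁xy) (in-X₂ x (E-V B x y Bxy)))
                                                  (sym (meet y (E-Vʳ X₁ x y X₁xy) (in-X₂ y (E-Vʳ B x y Bxy))))))
  ... | yes (x , p) = inj₁ (subgraph in-X₁ edges)
    where
    Bx : V B x ≡ true
    Bx = ∧-trueˡ p
    X₂x : V X₂ x ≡ false
    X₂x = not-true (∧-trueʳ {V B x} p)
    x≢c : x ≢ c
    x≢c refl = not-¬ X₂c X₂x
    X₁x : V X₁ x ≡ true
    X₁x with ∨-true (vertex B⊑X x Bx)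
    ... | inj₁ q = q
    ... | inj₂ q = ⊥-elim (not-¬ q X₂x)
    in-X₁ : ∀ y → V B y ≡ true → V X₁ y ≡ true
    in-X₁ y By with y ≟ c
    ... | yes refl = X₁c
    ... | no y≢c = ¬¬-true λ ¬X₁y → ConnNoCut⇒¬¬Connected-─ cnc c λ conn →
      ¬X₁y (walk-stays (⊑-trans (─-⊑ B c) B⊑X) (λ u p → proj₂ (V-─⁻ B c u p))
                       (conn x y (V-─⁺ B c x Bx x≢c) (V-─⁺ B c y By y≢c)) X₁x)
    edges : ∀ x y → E B x y ≡ true → E X₁ x y ≡ true
    edges x y Bxy with ∨-true (edge B⊑X x y Bxy)
    ... | inj₁ X₁xy = X₁xy
    ... | inj₂ X₂xy = ⊥-elim (E⇒≢ B x y Bxy (trans (meet x (in-X₁ x (E-V B x y Bxy)) (E-V X₂ x y X₂xy))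
                                                  (sym (meet y (in-X₁ y (E-Vʳ B x y Bxy)) (E-Vʳ X₂ x y X₂xy)))))

  blocks-∪ : ∀ {k} → (∀ B → IsBlockOf B X₁ → TdLe B k) → (∀ B → IsBlockOf B X₂ → TdLe B k) →
             ∀ B → IsBlockOf B (X₁ ∪ X₂) → TdLe B k
  blocks-∪ td₁ td₂ B block@(_ , cnc , _) with block-side cnc (block-⊑ block)
  ... | inj₁ B⊑X₁ = td₁ B (isBlockOf B⊑X₁ cnc λ H H⊑X₁ → block-maximal block H (⊑-trans H⊑X₁ (∪-⊑ˡ {Y = X₂})))
  ... | inj₂ B⊑X₂ = td₂ B (isBlockOf B⊑X₂ cnc λ H H⊑X₂ → block-maximal block H (⊑-trans H⊑X₂ (∪-⊑ʳ {X = X₁})))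

  block-∪ˡ : ConnNoCut X₁ → ∀ w → V X₁ w ≡ true → V X₂ w ≡ false → IsBlockOf X₁ (X₁ ∪ X₂)
  block-∪ˡ cnc w X₁w X₂w = isBlockOf ∪-⊑ˡ cnc maximal
    where
    maximal : ∀ H → H ⊑ (X₁ ∪ X₂) → X₁ ⊑ H → ConnNoCut H → H ⊑ X₁
    maximal H H⊑X X₁⊑H cncH with block-side cncH H⊑X
    ... | inj₁ H⊑X₁ = H⊑X₁
    ... | inj₂ H⊑X₂ = ⊥-elim (not-¬ (vertex H⊑X₂ w (vertex X₁⊑H w X₁w)) X₂w)

  block-∪ʳ : ∀ {B} → IsBlockOf B X₂ → ∀ w → V B w ≡ true → V X₁ w ≡ false → IsBlockOf B (X₁ ∪ X₂)
  block-∪ʳ {B} block@(_ , cnc , _) w Bw X₁w = isBlockOf (⊑-trans (block-⊑ block) ∪-⊑ʳ) cnc maximal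
    where
    maximal : ∀ H → H ⊑ (X₁ ∪ X₂) → B ⊑ H → ConnNoCut H → H ⊑ B
    maximal H H⊑X B⊑H cncH with block-side cncH H⊑X
    ... | inj₁ H⊑X₁ = ⊥-elim (not-¬ (vertex H⊑X₁ w (vertex B⊑H w Bw)) X₁w)
    ... | inj₂ H⊑X₂ = block-maximal block H H⊑X₂ B⊑H cncH

ConnNoCut⇒blocks : ∀ {n} {P : Graph n} {k} → ConnNoCut P → TdLe P k → ∀ B → IsBlockOf B P → TdLe B k
ConnNoCut⇒blocks cnc d B block = TdLe-≅ d (⊑-antisym (block-maximal block _ ⊑-refl (block-⊑ block) cnc) (block-⊑ block))

Cone⇒ConnNoCut : ∀ {n} {C : Graph n} {a} → Cone C a → Connected (C ─ a) → ConnNoCut C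
Cone⇒ConnNoCut cone C─a-conn =
  (_ , apex cone) , Cone⇒Connected cone , λ (v , _ , cut) → cut (Cone-─-Connected cone C─a-conn v)

TdLe-cone : ∀ {n} {C : Graph n} {a k} → Cone C a → Connected (C ─ a) → TdLe (C ─ a) k → TdLe C (suc k)
TdLe-cone cone C─a-conn d =
  td-block (isBlockOf ⊑-refl (Cone⇒ConnNoCut cone C─a-conn) (λ _ H⊑C _ _ → H⊑C)) _ (apex cone) d

record IsConeOver {n} (P H : Graph n) (a : Fin n) : Set where
  field
    cone : Cone P a
    base : (P ─ a) ≅ H

module _ {n} {P H : Graph n} {a} (P-H : IsConeOver P H a) where
  open IsConeOver P-H

  IsConeOver-─-connected : Connected H → Connected (P ─ a)
  IsConeOver-─-connected = Connected-≅ (≅-sym base)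

  IsConeOver-ConnNoCut : Connected H → ConnNoCut P
  IsConeOver-ConnNoCut H-conn = Cone⇒ConnNoCut cone (IsConeOver-─-connected H-conn)

  IsConeOver-TdLe : ∀ {k} → Connected H → TdLe H k → TdLe P (suc k)
  IsConeOver-TdLe H-conn d = TdLe-cone cone (IsConeOver-─-connected H-conn) (TdLe-≅ d (≅-sym base))

  IsConeOver-blocks : ∀ {k} → Connected H → TdLe H k → ∀ B → IsBlockOf B P → TdLe B (suc k)
  IsConeOver-blocks H-conn d = ConnNoCut⇒blocks (IsConeOver-ConnNoCut H-conn) (IsConeOver-TdLe H-conn d)

  IsConeOver-robust : ∀ {h} → (∀ x → RtdGe (H ─ x) h) → ∀ y → y ≢ a → RtdGe (P ─ y) (suc h)
  IsConeOver-robust H-robust y y≢a m d =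
    cone-bound d ⊑-refl (Cone-─ y cone y≢a) (RtdGe-⊑ H─y⊑ (H-robust y))
    where
    H─y⊑ : (H ─ y) ⊑ ((P ─ y) ─ a)
    H─y⊑ = ⊑-trans (─-mono y (≅⇒⊑ (≅-sym base))) (─-comm P a y)

-- The construction

len : ℕ → ℕ
len zero = 0
len (suc j) = 4 * len j + 5

module Construction (N : ℕ) where

  isAt : Fin N → ℕ → Bool
  isAt v p = toℕ v ℕ.≡ᵇ p

  isAt⁻ : ∀ {v p} → isAt v p ≡ true → toℕ v ≡ p
  isAt⁻ {v} {p} q = ≡ᵇ⇒≡ (toℕ v) p (Equivalence.from T-≡ q)

  isAt⁺ : ∀ {v p} → toℕ v ≡ p → isAt v p ≡ true
  isAt⁺ {v} {p} e = Equivalence.to T-≡ (≡⇒≡ᵇ (toℕ v) p e)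

  toℕ-≢ : ∀ {a b : Fin N} {p q} → toℕ a ≡ p → toℕ b ≡ q → p ≢ q → a ≢ b
  toℕ-≢ refl refl p≢q refl = p≢q refl

  point : ℕ → Graph N
  point p = record { V = λ v → isAt v p ; E = λ _ _ → false ; E-sym = λ _ _ → refl
                   ; E-irr = λ _ → refl ; E-V = λ _ _ () }

  cone : Graph N → ℕ → Graph N
  cone H p = record
    { V = λ v → isAt v p ∨ V H v
    ; E = λ x y → E H x y ∨ (spoke x y ∨ spoke y x)
    ; E-sym = λ x y → cong₂ _∨_ (E-sym H x y) (∨-comm (spoke x y) (spoke y x))
    ; E-irr = irr
    ; E-V = ends
    }
    where
    spoke : Fin N → Fin N → Bool
    spoke x y = isAt x p ∧ (V H y ∧ not (isAt y p))
    irr : ∀ x → E H x x ∨ (spoke x x ∨ spoke x x) ≡ false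
    irr x with E H x x | E-irr H x | isAt x p | V H x
    ... | false | _ | true | true = refl
    ... | false | _ | true | false = refl
    ... | false | _ | false | _ = refl
    ends : ∀ x y → E H x y ∨ (spoke x y ∨ spoke y x) ≡ true → isAt x p ∨ V H x ≡ true
    ends x y q with ∨-true q
    ... | inj₁ e = ∨-trueʳ (isAt x p) (E-V H x y e)
    ... | inj₂ r with ∨-true r
    ...   | inj₁ s = ∨-trueˡ (V H x) (∧-trueˡ s)
    ...   | inj₂ s = ∨-trueʳ (isAt x p) (∧-trueˡ (∧-trueʳ {isAt y p} s))

  V-cone⁻ : ∀ H p v → V (cone H p) v ≡ true → toℕ v ≡ p ⊎ V H v ≡ true
  V-cone⁻ H p v q with ∨-true q
  ... | inj₁ at = inj₁ (isAt⁻ at)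
  ... | inj₂ Hv = inj₂ Hv

  V-cone-apex : ∀ H p v → toℕ v ≡ p → V (cone H p) v ≡ true
  V-cone-apex H p v e = ∨-trueˡ (V H v) (isAt⁺ e)

  base-⊑-cone : ∀ {H p} → H ⊑ cone H p
  base-⊑-cone {H} {p} = subgraph (λ v q → ∨-trueʳ (isAt v p) q) (λ x y q → ∨-trueˡ _ q)

  Excludes : Graph N → ℕ → Set
  Excludes H p = ∀ v → V H v ≡ true → toℕ v ≢ p

  cone-IsConeOver : ∀ {H p} → Excludes H p → ∀ a → toℕ a ≡ p → IsConeOver (cone H p) H a
  cone-IsConeOver {H} {p} p∉H a a≡p = record
    { cone = record { apex = V-cone-apex H p a a≡p ; adjacent = adjacent′ }
    ; base = ⊑-antisym (subgraph vertices edges) (⊑-─ a base-⊑-cone λ v Hv v≡a → p∉H v Hv (trans (cong toℕ v≡a) a≡p))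
    }
    where
    at-p⇒a : ∀ {v} → isAt v p ≡ true → v ≡ a
    at-p⇒a q = toℕ-injective (trans (isAt⁻ q) (sym a≡p))
    adjacent′ : ∀ v → V (cone H p) v ≡ true → v ≢ a → E (cone H p) a v ≡ true
    adjacent′ v q v≢a with V-cone⁻ H p v q
    ... | inj₁ v≡p = ⊥-elim (v≢a (toℕ-injective (trans v≡p (sym a≡p))))
    ... | inj₂ Hv = ∨-trueʳ (E H a v) (∨-trueˡ _ (∧-true (isAt⁺ a≡p)
                      (∧-true Hv (not-false (¬-not λ at → p∉H v Hv (isAt⁻ at))))))
    vertices : ∀ v → V (cone H p ─ a) v ≡ true → V H v ≡ true
    vertices v q with V-─⁻ (cone H p) a v q
    ... | Pv , v≢a with ∨-true Pv
    ...   | inj₁ at = ⊥-elim (v≢a (at-p⇒a at))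
    ...   | inj₂ Hv = Hv
    edges : ∀ x y → E (cone H p ─ a) x y ≡ true → E H x y ≡ true
    edges x y q with E-─⁻ (cone H p) a x y q
    ... | Pxy , x≢a , y≢a with ∨-true Pxy
    ...   | inj₁ Hxy = Hxy
    ...   | inj₂ spokes with ∨-true spokes
    ...     | inj₁ s = ⊥-elim (x≢a (at-p⇒a (∧-trueˡ s)))
    ...     | inj₂ s = ⊥-elim (y≢a (at-p⇒a (∧-trueˡ s)))

  point-Cone : ∀ {p} a → toℕ a ≡ p → Cone (point p) a
  point-Cone a a≡p = record
    { apex = isAt⁺ a≡p
    ; adjacent = λ v q v≢a → ⊥-elim (v≢a (toℕ-injective (trans (isAt⁻ q) (sym a≡p))))
    }

  point-─-null : ∀ {p} a → toℕ a ≡ p → IsNull (point p ─ a)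
  point-─-null {p} a a≡p v = ¬-not λ q → let (at , v≢a) = V-─⁻ (point p) a v q in
    v≢a (toℕ-injective (trans (isAt⁻ at) (sym a≡p)))

  point-connected : ∀ p → Connected (point p)
  point-connected p x y q r = subst (Reach (point p) x) (toℕ-injective (trans (isAt⁻ q) (sym (isAt⁻ r)))) (here q)

  point-TdLe : ∀ {p k} a → toℕ a ≡ p → TdLe (point p) (suc k)
  point-TdLe a a≡p = TdLe-cone (point-Cone a a≡p) (λ x _ q → ⊥-elim (not-¬ q (point-─-null a a≡p x)))
                                (td-null (point-─-null a a≡p))

  InRange : Graph N → ℕ → ℕ → Set
  InRange G lo hi = ∀ v → V G v ≡ true → lo ≤ toℕ v × toℕ v ≤ hi

  -- Vertices are located by their index toℕ v; pieces occupying consecutive intervals of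
  -- indices share exactly the endpoint between them.
  record Segment (G : Graph N) (lo hi : ℕ) : Set where
    field
      lo≤hi : lo ≤ hi
      range : InRange G lo hi
      first : ∀ v → toℕ v ≡ lo → V G v ≡ true
      last  : ∀ v → toℕ v ≡ hi → V G v ≡ true

  Segment-point : ∀ p → Segment (point p) p p
  Segment-point p = record
    { lo≤hi = ≤-refl
    ; range = λ v q → let v≡p = isAt⁻ q in ≤-reflexive (sym v≡p) , ≤-reflexive v≡p
    ; first = λ v e → isAt⁺ e
    ; last = λ v e → isAt⁺ e
    }

  Segment-cone-left : ∀ {H p hi} → Segment H (suc p) hi → Segment (cone H p) p hi
  Segment-cone-left {H} {p} {hi} sH = record
    { lo≤hi = ≤-trans (n≤1+n p) lo≤hi
    ; range = range′
    ; first = V-cone-apex H p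
    ; last = λ v e → vertex (base-⊑-cone {H} {p}) v (last v e)
    }
    where
    open Segment sH
    range′ : InRange (cone H p) p hi
    range′ v q with V-cone⁻ H p v q
    ... | inj₁ v≡p = ≤-reflexive (sym v≡p) , ≤-trans (≤-reflexive v≡p) (≤-trans (n≤1+n p) lo≤hi)
    ... | inj₂ Hv = ≤-trans (n≤1+n p) (proj₁ (range v Hv)) , proj₂ (range v Hv)

  Segment-cone-right : ∀ {H lo hi} → Segment H lo hi → Segment (cone H (suc hi)) lo (suc hi)
  Segment-cone-right {H} {lo} {hi} sH = record
    { lo≤hi = ≤-trans lo≤hi (n≤1+n hi)
    ; range = range′
    ; first = λ v e → vertex (base-⊑-cone {H} {suc hi}) v (first v e)
    ; last = V-cone-apex H (suc hi)
    }
    where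
    open Segment sH
    range′ : InRange (cone H (suc hi)) lo (suc hi)
    range′ v q with V-cone⁻ H (suc hi) v q
    ... | inj₁ v≡p = ≤-trans (≤-trans lo≤hi (n≤1+n hi)) (≤-reflexive (sym v≡p)) , ≤-reflexive v≡p
    ... | inj₂ Hv = proj₁ (range v Hv) , ≤-trans (proj₂ (range v Hv)) (n≤1+n hi)

  cone-left-IsConeOver : ∀ {H p hi} → Segment H (suc p) hi → ∀ a → toℕ a ≡ p → IsConeOver (cone H p) H a
  cone-left-IsConeOver sH = cone-IsConeOver λ v Hv v≡p →
    <⇒≢ (proj₁ (Segment.range sH v Hv)) (sym v≡p)

  cone-right-IsConeOver : ∀ {H lo hi} → Segment H lo hi → ∀ a → toℕ a ≡ suc hi → IsConeOver (cone H (suc hi)) H a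
  cone-right-IsConeOver sH = cone-IsConeOver λ v Hv → <⇒≢ (s≤s (proj₂ (Segment.range sH v Hv)))

  absent-below : ∀ {G lo hi} → Segment G lo hi → ∀ v {p} → toℕ v ≡ p → p < lo → V G v ≡ false
  absent-below sG v refl v<lo = ¬-not λ Gv → <⇒≢ (≤-trans v<lo (proj₁ (Segment.range sG v Gv))) refl

  absent-above : ∀ {G lo hi} → Segment G lo hi → ∀ v {p} → toℕ v ≡ p → hi < p → V G v ≡ false
  absent-above sG v refl hi<v = ¬-not λ Gv → <⇒≢ (≤-<-trans (proj₂ (Segment.range sG v Gv)) hi<v) refl

  avoids-below : ∀ {G lo hi} → Segment G lo hi → ∀ {x} → toℕ x < lo → ∀ v → V G v ≡ true → v ≢ x
  avoids-below sG x<lo v Gv refl = not-¬ Gv (absent-below sG v refl x<lo)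

  avoids-above : ∀ {G lo hi} → Segment G lo hi → ∀ {x} → hi < toℕ x → ∀ v → V G v ≡ true → v ≢ x
  avoids-above sG hi<x v Gv refl = not-¬ Gv (absent-above sG v refl hi<x)

  Segment-∪ : ∀ {X Y lo mid hi} → Segment X lo mid → Segment Y mid hi → Segment (X ∪ Y) lo hi
  Segment-∪ {X} {Y} {lo} {mid} {hi} sX sY = record
    { lo≤hi = ≤-trans (Segment.lo≤hi sX) (Segment.lo≤hi sY)
    ; range = range′
    ; first = λ v e → ∨-trueˡ (V Y v) (Segment.first sX v e)
    ; last = λ v e → ∨-trueʳ (V X v) (Segment.last sY v e)
    }
    where
    range′ : InRange (X ∪ Y) lo hi
    range′ v q with ∨-true q
    ... | inj₁ Xv = proj₁ (Segment.range sX v Xv) , ≤-trans (proj₂ (Segment.range sX v Xv)) (Segment.lo≤hi sY)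
    ... | inj₂ Yv = ≤-trans (Segment.lo≤hi sX) (proj₁ (Segment.range sY v Yv)) , proj₂ (Segment.range sY v Yv)


  module Joint {X Y : Graph N} {lo mid hi} (sX : Segment X lo mid) (sY : Segment Y mid hi)
               (m : Fin N) (m≡mid : toℕ m ≡ mid) where

    meet : ∀ v → V X v ≡ true → V Y v ≡ true → v ≡ m
    meet v Xv Yv = toℕ-injective (trans (≤-antisym (proj₂ (Segment.range sX v Xv)) (proj₁ (Segment.range sY v Yv)))
                                        (sym m≡mid))

    open Glue X Y m (Segment.last sX m m≡mid) (Segment.first sY m m≡mid) meet public

    connected : Connected X → Connected Y → Connected (X ∪ Y)
    connected = ∪-connected m (Segment.last sX m m≡mid) (Segment.first sY m m≡mid)

    bouquet : ∀ {H H′ a a′ h} → IsConeOver X H a → IsConeOver Y H′ a′ → m ≢ a → m ≢ a′ →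
              Connected H → Connected H′ → (∀ x → RtdGe (H ─ x) h) → (∀ x → RtdGe (H′ ─ x) h) →
              Bouquet X Y a a′ m (suc h)
    bouquet X-H Y-H′ m≢a m≢a′ H-conn H′-conn H-robust H′-robust = record
      { cone = IsConeOver.cone X-H
      ; cone′ = IsConeOver.cone Y-H′
      ; joint = Segment.last sX m m≡mid
      ; joint′ = Segment.first sY m m≡mid
      ; joint≢apex = m≢a
      ; joint≢apex′ = m≢a′
      ; meet = meet
      ; connected = IsConeOver-─-connected X-H H-conn
      ; connected′ = IsConeOver-─-connected Y-H′ H′-conn
      ; robust = IsConeOver-robust X-H H-robust
      ; robust′ = IsConeOver-robust Y-H′ H′-robust
      }

  -- F o spans [o, o + l]; the pieces P₁ … P₅ span [o, p₁], [p₁, p₂], …, [p₄, p₅], with apexes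
  -- o, p₂, p₂, p₃, p₅. The edge P₃ keeps the bouquets {P₁, P₂} and {P₄, P₅} vertex-disjoint.
  module Step (F : ℕ → Graph N) (l o : ℕ) where
    p₁ p₂ p₃ p₄ p₅ : ℕ
    p₁ = suc (o + l)
    p₂ = suc (p₁ + l)
    p₃ = suc p₂
    p₄ = suc (p₃ + l)
    p₅ = suc (p₄ + l)

    P₁ P₂ P₃ P₄ P₅ R₂ R₃ R₄ graph : Graph N
    P₁ = cone (F (suc o)) o
    P₂ = cone (F p₁) p₂
    P₃ = cone (point p₃) p₂
    P₄ = cone (F (suc p₃)) p₃
    P₅ = cone (F p₄) p₅
    R₄ = P₄ ∪ P₅
    R₃ = P₃ ∪ R₄
    R₂ = P₂ ∪ R₃
    graph = P₁ ∪ R₂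

    <-step : ∀ p → p < suc (p + l)
    <-step p = s≤s (m≤m+n p l)

    P₁⊑graph : P₁ ⊑ graph
    P₁⊑graph = ∪-⊑ˡ
    P₂⊑graph : P₂ ⊑ graph
    P₂⊑graph = ⊑-trans (∪-⊑ˡ {Y = R₃}) (∪-⊑ʳ {X = P₁})
    P₄⊑graph : P₄ ⊑ graph
    P₄⊑graph = ⊑-trans (∪-⊑ˡ {Y = P₅}) (⊑-trans (∪-⊑ʳ {X = P₃}) (⊑-trans (∪-⊑ʳ {X = P₂}) (∪-⊑ʳ {X = P₁})))
    P₅⊑graph : P₅ ⊑ graph
    P₅⊑graph = ⊑-trans (∪-⊑ʳ {X = P₄}) (⊑-trans (∪-⊑ʳ {X = P₃}) (⊑-trans (∪-⊑ʳ {X = P₂}) (∪-⊑ʳ {X = P₁})))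

    module _ (F-segment : ∀ o → Segment (F o) o (o + l)) where

      seg₁ : Segment P₁ o p₁
      seg₁ = Segment-cone-left (F-segment (suc o))
      seg₂ : Segment P₂ p₁ p₂
      seg₂ = Segment-cone-right (F-segment p₁)
      seg₃ : Segment P₃ p₂ p₃
      seg₃ = Segment-cone-left (Segment-point p₃)
      seg₄ : Segment P₄ p₃ p₄
      seg₄ = Segment-cone-left (F-segment (suc p₃))
      seg₅ : Segment P₅ p₄ p₅
      seg₅ = Segment-cone-right (F-segment p₄)

      segR₄ : Segment R₄ p₃ p₅
      segR₄ = Segment-∪ seg₄ seg₅
      segR₃ : Segment R₃ p₂ p₅
      segR₃ = Segment-∪ seg₃ segR₄
      segR₂ : Segment R₂ p₁ p₅
      segR₂ = Segment-∪ seg₂ segR₃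
      segment : Segment graph o p₅
      segment = Segment-∪ seg₁ segR₂

      module Bounded (p₅<N : p₅ < N) where

        fin-at : ∀ p → p ≤ p₅ → Fin N
        fin-at p p≤p₅ = fromℕ< (≤-<-trans p≤p₅ p₅<N)

        toℕ-fin-at : ∀ p p≤p₅ → toℕ (fin-at p p≤p₅) ≡ p
        toℕ-fin-at p p≤p₅ = toℕ-fromℕ< (≤-<-trans p≤p₅ p₅<N)

        a₀ a₁ a₂ a₃ a₄ a₅ : Fin N
        a₀ = fin-at o (Segment.lo≤hi segment)
        a₁ = fin-at p₁ (Segment.lo≤hi segR₂)
        a₂ = fin-at p₂ (Segment.lo≤hi segR₃)
        a₃ = fin-at p₃ (Segment.lo≤hi segR₄)
        a₄ = fin-at p₄ (Segment.lo≤hi seg₅)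
        a₅ = fin-at p₅ ≤-refl

        e₀ : toℕ a₀ ≡ o
        e₀ = toℕ-fin-at o (Segment.lo≤hi segment)
        e₁ : toℕ a₁ ≡ p₁
        e₁ = toℕ-fin-at p₁ (Segment.lo≤hi segR₂)
        e₂ : toℕ a₂ ≡ p₂
        e₂ = toℕ-fin-at p₂ (Segment.lo≤hi segR₃)
        e₃ : toℕ a₃ ≡ p₃
        e₃ = toℕ-fin-at p₃ (Segment.lo≤hi segR₄)
        e₄ : toℕ a₄ ≡ p₄
        e₄ = toℕ-fin-at p₄ (Segment.lo≤hi seg₅)
        e₅ : toℕ a₅ ≡ p₅
        e₅ = toℕ-fin-at p₅ ≤-refl

        fits₁ : suc o + l < N
        fits₁ = ≤-<-trans (Segment.lo≤hi segR₂) p₅<N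
        fits₂ : p₁ + l < N
        fits₂ = ≤-<-trans (≤-trans (n≤1+n _) (Segment.lo≤hi segR₃)) p₅<N
        fits₄ : suc p₃ + l < N
        fits₄ = ≤-<-trans (Segment.lo≤hi seg₅) p₅<N
        fits₅ : p₄ + l < N
        fits₅ = ≤-<-trans (n≤1+n _) p₅<N

        cone₁ : IsConeOver P₁ (F (suc o)) a₀
        cone₁ = cone-left-IsConeOver (F-segment (suc o)) a₀ e₀
        cone₂ : IsConeOver P₂ (F p₁) a₂
        cone₂ = cone-right-IsConeOver (F-segment p₁) a₂ e₂
        cone₃ : IsConeOver P₃ (point p₃) a₂
        cone₃ = cone-left-IsConeOver (Segment-point p₃) a₂ e₂
        cone₄ : IsConeOver P₄ (F (suc p₃)) a₃
        cone₄ = cone-left-IsConeOver (F-segment (suc p₃)) a₃ e₃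
        cone₅ : IsConeOver P₅ (F p₄) a₅
        cone₅ = cone-right-IsConeOver (F-segment p₄) a₅ e₅

        module J₁ = Joint seg₁ segR₂ a₁ e₁
        module J₂ = Joint seg₂ segR₃ a₂ e₂
        module J₃ = Joint seg₃ segR₄ a₃ e₃
        module J₄ = Joint seg₄ seg₅ a₄ e₄
        module J₁₂ = Joint seg₁ seg₂ a₁ e₁

        connected : Connected graph
        connected = J₁.connected (Cone⇒Connected (IsConeOver.cone cone₁))
                   (J₂.connected (Cone⇒Connected (IsConeOver.cone cone₂))
                   (J₃.connected (Cone⇒Connected (IsConeOver.cone cone₃))
                   (J₄.connected (Cone⇒Connected (IsConeOver.cone cone₄))
                                 (Cone⇒Connected (IsConeOver.cone cone₅)))))

        td : ∀ {k} → (∀ o → o + l < N → Connected (F o)) → (∀ o → o + l < N → TdLe (F o) (suc k)) →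
             TdLe graph (suc (suc k))
        td F-connected F-td =
          td-blocks (P₁ , P₂ , block₁ , block₂ , P₁≉P₂)
            (J₁.blocks-∪ (IsConeOver-blocks cone₁ (F-connected _ fits₁) (F-td _ fits₁))
            (J₂.blocks-∪ (IsConeOver-blocks cone₂ (F-connected _ fits₂) (F-td _ fits₂))
            (J₃.blocks-∪ (IsConeOver-blocks cone₃ (point-connected p₃) (point-TdLe a₃ e₃))
            (J₄.blocks-∪ (IsConeOver-blocks cone₄ (F-connected _ fits₄) (F-td _ fits₄))
                         (IsConeOver-blocks cone₅ (F-connected _ fits₅) (F-td _ fits₅))))))
          where
          block₁ : IsBlockOf P₁ graph
          block₁ = J₁.block-∪ˡ (IsConeOver-ConnNoCut cone₁ (F-connected _ fits₁))
                     a₀ (Segment.first seg₁ a₀ e₀) (absent-below segR₂ a₀ e₀ (<-step o))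
          block₂ : IsBlockOf P₂ graph
          block₂ = J₁.block-∪ʳ (J₂.block-∪ˡ (IsConeOver-ConnNoCut cone₂ (F-connected _ fits₂))
                                 a₁ (Segment.first seg₂ a₁ e₁) (absent-below segR₃ a₁ e₁ (<-step p₁)))
                     a₂ (Segment.last seg₂ a₂ e₂) (absent-above seg₁ a₂ e₂ (<-step p₁))
          P₁≉P₂ : ¬ SameGraph P₁ P₂
          P₁≉P₂ (V≡ , _) = not-¬ (trans (sym (V≡ a₀)) (Segment.first seg₁ a₀ e₀)) (absent-below seg₂ a₀ e₀ (<-step o))

        robust : ∀ {h} → (∀ o → o + l < N → Connected (F o)) → (∀ o → o + l < N → ∀ x → RtdGe (F o ─ x) h) →
                 ∀ x → RtdGe (graph ─ x) (suc (suc h))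
        robust F-connected F-robust x m d with toℕ x ≤? p₂
        ... | yes x≤p₂ = bouquet-bound d
                (J₄.bouquet cone₄ cone₅ (toℕ-≢ e₄ e₃ (>⇒≢ (<-step p₃))) (toℕ-≢ e₄ e₅ (<⇒≢ (<-step p₄)))
                   (F-connected _ fits₄) (F-connected _ fits₅) (F-robust _ fits₄) (F-robust _ fits₅))
                (⊑-─ x P₄⊑graph (avoids-below seg₄ (s≤s x≤p₂)))
                (⊑-─ x P₅⊑graph (avoids-below seg₅ (≤-trans (s≤s x≤p₂) (Segment.lo≤hi seg₄))))
        ... | no x≰p₂ = bouquet-bound d
                (J₁₂.bouquet cone₁ cone₂ (toℕ-≢ e₁ e₀ (>⇒≢ (<-step o))) (toℕ-≢ e₁ e₂ (<⇒≢ (<-step p₁)))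
                   (F-connected _ fits₁) (F-connected _ fits₂) (F-robust _ fits₁) (F-robust _ fits₂))
                (⊑-─ x P₁⊑graph (avoids-above seg₁ (≤-<-trans (Segment.lo≤hi seg₂) (≰⇒> x≰p₂))))
                (⊑-─ x P₂⊑graph (avoids-above seg₂ (≰⇒> x≰p₂)))

  Gen : ℕ → ℕ → Graph N
  Gen zero o = point o
  Gen (suc j) o = Step.graph (Gen j) (len j) o

  five-pieces : ∀ o l → o + (4 * l + 5) ≡ suc (suc (suc (suc (suc (o + l) + l)) + l) + l)
  five-pieces = solve-∀

  Gen-segment : ∀ j o → Segment (Gen j o) o (o + len j)
  Gen-segment zero o = subst (Segment (point o) o) (sym (+-identityʳ o)) (Segment-point o)
  Gen-segment (suc j) o = subst (Segment (Gen (suc j) o) o) (sym (five-pieces o (len j)))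
                                (Step.segment (Gen j) (len j) o (Gen-segment j))

  module Bounded (j o : ℕ) (fits : o + len (suc j) < N) =
    Step.Bounded (Gen j) (len j) o (Gen-segment j) (subst (_< N) (five-pieces o (len j)) fits)

  Gen-connected : ∀ j o → o + len j < N → Connected (Gen j o)
  Gen-connected zero o _ = point-connected o
  Gen-connected (suc j) o fits = Bounded.connected j o fits

  Gen-td : ∀ j o → o + len j < N → TdLe (Gen j o) (suc j)
  Gen-td zero o fits = point-TdLe (fromℕ< o<N) (toℕ-fromℕ< o<N)
    where o<N = ≤-<-trans (m≤m+n o 0) fits
  Gen-td (suc j) o fits = Bounded.td j o fits (Gen-connected j) (Gen-td j)

  Gen-robust : ∀ j o → o + len j < N → ∀ x → RtdGe (Gen j o ─ x) (j + j)
  Gen-robust zero o _ _ _ _ = z≤n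
  Gen-robust (suc j) o fits x = subst (RtdGe (Gen (suc j) o ─ x)) (cong suc (sym (+-suc j j)))
                                      (Bounded.robust j o fits (Gen-connected j) (Gen-robust j) x)

2[2+i]∸2≡[1+i]+[1+i] : ∀ i → 2 * suc (suc i) ∸ 2 ≡ suc i + suc i
2[2+i]∸2≡[1+i]+[1+i] i = trans (+-suc i (suc (i + 0))) (cong (λ t → suc (i + suc t)) (+-identityʳ i))

lemma27 : ∀ (k : ℕ) → 2 ≤ k →
    Σ ℕ λ n → Σ (Graph n) λ G →
      TdLe G k × (∀ m → RtdLe G m → 2 * k ∸ 2 ≤ m)
lemma27 (suc (suc i)) (s≤s (s≤s z≤n)) =
  N , Gen (suc i) 0 , Gen-td (suc i) 0 ≤-refl ,
  λ m d → subst (_≤ m) (sym (2[2+i]∸2≡[1+i]+[1+i] i))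
                (RtdGe-⊑ (─-⊑ (Gen (suc i) 0) zero) (Gen-robust (suc i) 0 ≤-refl zero) m d)
  where
  N = suc (len (suc i))
  open Construction N
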